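{- Let $(G,\sigma)$ be a signed graph without long barbells and $(\tau,f)$ a $k$-flow of $(G,\sigma)$. Let $(Q,\sigma|_{E(Q)})$ be the subgraph of $(G,\sigma)$ induced by the edge set $\{e: f(e)\equiv 1\pmod 2\}$. Then every component of $(Q,\sigma|_{E(Q)})$ has an even number of negative edges, and $(Q,\sigma|_{E(Q)})$ admits a nowhere-zero $2$-flow.
   Context: A signed graph $(G,\sigma)$ is a graph $G$ with a signature $\sigma:E(G)\to\{ -1,+1\}$; edges with $\sigma(e)=-1$ are negative. A circuit is balanced if it contains an even number of negative edges and unbalanced otherwise. A long barbell is the union of two vertex-disjoint unbalanced circuits together with a path meeting the circuits only at its two ends. Each edge $e=uv$ consists of half-edges $h_e^u$ and $h_e^v$; $H(v)$ is the set of half-edges at $v$. An orientation is a map $\tau$ from half-edges to $\{\pm1\}$ with $\tau(h_e^u)\tau(h_e^v)=-\sigma(e)$. A $k$-flow $(\tau,f)$ is an orientation with $f:E(G)\to\mathbb{Z}$, $|f(e)|\le k-1$, and $\sum_{h\in H(v)}\tau(h)f(e_h)=0$ for all vertices $v$ ($e_h$ the edge containing $h$). A nowhere-zero $2$-flow is such a flow (for some orientation) with $f(e)\in\{ -1,1\}$ for all edges. -}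

module Defs where

open import Data.Nat as ℕ using (ℕ; zero; suc; _∸_; _%_)
open import Data.Nat.DivMod using (m%n<n)
open import Data.Nat.Divisibility as ℕD using ()
open import Data.Integer as ℤ using (ℤ; +_; -_; _*_; _+_; ∣_∣)
open import Data.Bool using (Bool; true; false; if_then_else_; T)
open import Data.Fin using (Fin; zero; suc; toℕ; fromℕ<; fromℕ; inject₁; _≟_)
open import Data.List using (List; length)
open import Data.List.Membership.Propositional using (_∈_)
open import Data.List.Relation.Unary.Unique.Propositional using (Unique)
open import Data.Product using (Σ; ∃; _×_; _,_)
open import Data.Sum using (_⊎_)
open import Function.Bundles using (_⇔_)
open import Function.Definitions using (Injective)
open import Relation.Binary.PropositionalEquality using (_≡_; _≢_)
open import Relation.Nullary using (¬_)
open import Relation.Nullary.Decidable using (⌊_⌋)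

data Sign : Set where
  plus minus : Sign

⟦_⟧ : Sign → ℤ
⟦ plus ⟧  = + 1
⟦ minus ⟧ = - (+ 1)

isNeg : Sign → Bool
isNeg plus  = false
isNeg minus = true

-- Finite signed graphs (loops and parallel edges allowed).
-- Vertices Fin n, edges Fin m.  Edge e has two half-edges:
-- (e , false) at vertex src e and (e , true) at vertex tgt e.

record SignedGraph : Set where
  field
    n   : ℕ
    m   : ℕ
    src : Fin m → Fin n
    tgt : Fin m → Fin n
    σ   : Fin m → Sign

open SignedGraph public

endOf : (G : SignedGraph) → Fin (m G) → Bool → Fin (n G)
endOf G e false = src G e
endOf G e true  = tgt G e

Joins : (G : SignedGraph) → Fin (m G) → Fin (n G) → Fin (n G) → Set
Joins G e x y = (src G e ≡ x × tgt G e ≡ y) ⊎ (src G e ≡ y × tgt G e ≡ x)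

∑ : (k : ℕ) → (Fin k → ℤ) → ℤ
∑ zero    g = + 0
∑ (suc k) g = g zero + ∑ k (λ i → g (suc i))

count : (k : ℕ) → (Fin k → Bool) → ℕ
count zero    P = 0
count (suc k) P = (if P zero then 1 else 0) ℕ.+ count k (λ i → P (suc i))

OddNat : ℕ → Set
OddNat a = ¬ (2 ℕD.∣ a)

EvenNat : ℕ → Set
EvenNat a = 2 ℕD.∣ a

EvenCard : {k : ℕ} → (Fin k → Set) → Set
EvenCard {k} P = Σ (List (Fin k)) λ l →
  Unique l × (∀ e → (e ∈ l) ⇔ P e) × EvenNat (length l)

next : {l : ℕ} → Fin (suc l) → Fin (suc l)
next {l} i = fromℕ< (m%n<n (suc (toℕ i)) (suc l))

-- A circuit: distinct vertices v_0..v_l and distinct edges e_0..e_l,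
-- e_i joining v_i and v_{i+1 mod (l+1)}.  (l = 0: a loop.)
record Circuit (G : SignedGraph) : Set where
  field
    len   : ℕ
    verts : Fin (suc len) → Fin (n G)
    edges : Fin (suc len) → Fin (m G)
    verts-inj : Injective _≡_ _≡_ verts
    edges-inj : Injective _≡_ _≡_ edges
    joins : ∀ i → Joins G (edges i) (verts i) (verts (next i))

open Circuit public

OnCircuit : {G : SignedGraph} → Circuit G → Fin (n G) → Set
OnCircuit C x = ∃ λ i → verts C i ≡ x

Unbalanced : {G : SignedGraph} → Circuit G → Set
Unbalanced {G} C = OddNat (count (suc (len C)) (λ i → isNeg (σ G (edges C i))))

-- A path with distinct vertices w_0..w_{p+1} (length p+1 ≥ 1),
-- edge d_i joining w_i and w_{i+1}.
record Path (G : SignedGraph) : Set where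
  field
    plen  : ℕ
    pverts : Fin (suc (suc plen)) → Fin (n G)
    pedges : Fin (suc plen) → Fin (m G)
    pverts-inj : Injective _≡_ _≡_ pverts
    pjoins : ∀ i → Joins G (pedges i) (pverts (inject₁ i)) (pverts (suc i))

open Path public

startP : {G : SignedGraph} → Path G → Fin (n G)
startP P = pverts P zero

endP : {G : SignedGraph} → Path G → Fin (n G)
endP P = pverts P (fromℕ (suc (plen P)))

record LongBarbell (G : SignedGraph) : Set where
  field
    C₁ C₂ : Circuit G
    unb₁ : Unbalanced C₁
    unb₂ : Unbalanced C₂
    disjoint : ∀ i j → verts C₁ i ≢ verts C₂ j
    P : Path G
    start-on : OnCircuit C₁ (startP P)
    end-on   : OnCircuit C₂ (endP P)
    inner-off : ∀ j → (OnCircuit C₁ (pverts P j) ⊎ OnCircuit C₂ (pverts P j)) →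
                (j ≡ zero) ⊎ (j ≡ fromℕ (suc (plen P)))

-- Orientations and flows on the spanning subgraph with edge set
-- {e | S e ≡ true}.  (S = λ _ → true gives the whole graph.)

Orientation : SignedGraph → Set
Orientation G = Fin (m G) → Bool → Sign

IsOrientationOn : (G : SignedGraph) → (Fin (m G) → Bool) → Orientation G → Set
IsOrientationOn G S τ =
  ∀ e → T (S e) → ⟦ τ e false ⟧ * ⟦ τ e true ⟧ ≡ - ⟦ σ G e ⟧

half : (G : SignedGraph) → Orientation G → (Fin (m G) → ℤ) →
       Fin (n G) → Fin (m G) → Bool → ℤ
half G τ f v e b = if ⌊ endOf G e b ≟ v ⌋ then ⟦ τ e b ⟧ * f e else + 0

boundary : (G : SignedGraph) → (Fin (m G) → Bool) → Orientation G →
           (Fin (m G) → ℤ) → Fin (n G) → ℤ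
boundary G S τ f v =
  ∑ (m G) (λ e → if S e then half G τ f v e false + half G τ f v e true else + 0)

all : {k : ℕ} → Fin k → Bool
all _ = true

IsKFlow : (G : SignedGraph) → ℕ → Orientation G → (Fin (m G) → ℤ) → Set
IsKFlow G k τ f =
  IsOrientationOn G all τ ×
  (∀ e → ∣ f e ∣ ℕ.≤ k ∸ 1) ×
  (∀ v → boundary G all τ f v ≡ + 0)

HasNZ2FlowOn : (G : SignedGraph) → (Fin (m G) → Bool) → Set
HasNZ2FlowOn G S = Σ (Orientation G) λ τ → Σ (Fin (m G) → ℤ) λ g →
  IsOrientationOn G S τ ×
  (∀ e → T (S e) → (g e ≡ + 1) ⊎ (g e ≡ - (+ 1))) ×
  (∀ v → boundary G S τ g v ≡ + 0)

oddℤ : ℤ → Bool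
oddℤ z = (∣ z ∣ % 2) ℕ.≡ᵇ 1

data Reach (G : SignedGraph) (S : Fin (m G) → Bool) (v : Fin (n G)) :
     Fin (n G) → Set where
  here : Reach G S v v
  step : ∀ {w x} e → Reach G S v w → T (S e) → Joins G e w x → Reach G S v x

NegEdgeOfComponent : (G : SignedGraph) → (Fin (m G) → Bool) → Fin (n G) →
                     Fin (m G) → Set
NegEdgeOfComponent G S v e = T (S e) × Reach G S v (src G e) × σ G e ≡ minus

-- Reduced modulo 2, flow conservation says that every vertex meets an even number of odd edges.
-- Weighting the conservation law at each vertex of a set U by ±1, according to a switching s, and
-- summing gives, modulo 4, twice the number of odd edges inside U that are negative after
-- switching, plus the flow on edges leaving U; if no odd edge leaves U the parity of that number
-- therefore does not depend on s. Choose s to make each balanced component of the odd subgraph Q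
-- all positive. The remaining negative edges lie in unbalanced components, and two of those joined
-- in G would give a long barbell, so for a set U closed in Q they can be counted inside a set closed
-- in G, where the count is even. Thus every closed set of Q, in particular every component,
-- contains an even number of negative edges. An even signed graph with this property has a
-- nowhere-zero 2-flow: remove a positive loop, or split off two edges at a vertex chosen so that
-- degrees and closed sets stay even, and lift the flow of the smaller graph.

module Submission where

open import Defs
open import Algebra.Bundles using (CommutativeMonoid; CommutativeRing)
import Algebra.Properties.CommutativeMonoid.Sum as CommutativeMonoidSum
import Algebra.Properties.Semiring.Sum as SemiringSum
open import Data.Nat as ℕ using (ℕ; zero; suc; _+_; _*_; _%_; _/_; _≤_; _<_; z≤n; s≤s; _∸_; _<ᵇ_)
import Data.Nat.Properties as ℕP
open import Data.Integer as ℤ using (ℤ; +_; -[1+_]; -_; ∣_∣)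
import Data.Integer.Properties as ℤP
open import Data.Bool using (Bool; true; false; if_then_else_; T; not; _∧_; _xor_; _∨_)
open import Data.Fin using (Fin; zero; suc; _≟_; toℕ; fromℕ)
open import Relation.Binary.PropositionalEquality
open import Relation.Nullary.Decidable using (⌊_⌋; dec-true; dec-false; isYes≗does; T?; toWitness; fromWitness; _×-dec_; map′; _⊎-dec_)
import Data.Fin.Properties as FP
open import Data.Product using (∃; _,_; Σ; _×_; proj₁; proj₂)
open import Data.Unit using (tt)
open import Data.Empty using (⊥-elim; ⊥)
open import Relation.Nullary using (¬_; Dec; yes; no; ¬?)
open import Data.Integer.Divisibility.Signed as ℤD using (divides)
import Data.Integer.Tactic.RingSolver as ℤSolver
open import Data.Nat.DivMod using (m≡m%n+[m/n]*n; m%n<n; m<n⇒m%n≡m; n%n≡0)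
open import Data.Nat.Divisibility using (divides; _∣?_; ∣m∣n⇒∣m+n; ∣m+n∣m⇒∣n)
open import Data.Bool.Properties using (not-distribˡ-xor; not-involutive; xor-assoc; not-distribʳ-xor; ∧-zeroʳ; ∧-identityʳ; xor-same; xor-∧-commutativeRing; T-∧; T-∨; T-≡; xor-comm; ∨-zeroʳ; ∨-identityʳ; xor-identityʳ)
import Algebra.Properties.CommutativeSemigroup
open import Data.Nat.Induction using (<-rec)
open import Function.Bundles using (Equivalence; mk⇔)
open import Data.Sum using (_⊎_; inj₁; inj₂)
open import Relation.Binary.Definitions using (tri<; tri≈; tri>)
import Data.List as List
open import Data.List.Relation.Unary.Unique.Propositional.Properties using (filter⁺; allFin⁺)
open import Data.List.Membership.Propositional.Properties using (∈-filter⁺; ∈-filter⁻; ∈-allFin)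
import Data.Nat.Tactic.RingSolver as ℕSolver
open Equivalence using (to; from)

ind : Bool → ℕ
ind b = if b then 1 else 0

indℤ : Bool → ℤ
indℤ b = + ind b

_==_ : {k : ℕ} → Fin k → Fin k → Bool
x == y = ⌊ x ≟ y ⌋

==-refl : {k : ℕ} (x : Fin k) → (x == x) ≡ true
==-refl x = trans (isYes≗does (x ≟ x)) (dec-true (x ≟ x) refl)

==-≢ : {k : ℕ} {x y : Fin k} → x ≢ y → (x == y) ≡ false
==-≢ {x = x} {y} x≢y = trans (isYes≗does (x ≟ y)) (dec-false (x ≟ y) x≢y)

==-suc : {k : ℕ} (x y : Fin k) → (suc x == suc y) ≡ (x == y)
==-suc x y = trans (isYes≗does (suc x ≟ suc y)) (sym (isYes≗does (x ≟ y)))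

T-extensional : {a b : Bool} → (T a → T b) → (T b → T a) → a ≡ b
T-extensional {true} {true} _ _ = refl
T-extensional {true} {false} a→b _ = ⊥-elim (a→b tt)
T-extensional {false} {true} _ b→a = ⊥-elim (b→a tt)
T-extensional {false} {false} _ _ = refl

¬T⇒≡false : {b : Bool} → ¬ T b → b ≡ false
¬T⇒≡false {true} ¬t = ⊥-elim (¬t tt)
¬T⇒≡false {false} _ = refl

anyᵇ : {k : ℕ} → (Fin k → Bool) → Bool
anyᵇ P = ⌊ FP.any? (λ i → T? (P i)) ⌋

anyᵇ-sound : {k : ℕ} (P : Fin k → Bool) → T (anyᵇ P) → ∃ λ i → T (P i)
anyᵇ-sound P = toWitness

anyᵇ-complete : {k : ℕ} (P : Fin k → Bool) (i : Fin k) → T (P i) → T (anyᵇ P)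
anyᵇ-complete P i p = fromWitness (i , p)

avoid₂ : {k : ℕ} → Fin k → Fin k → Fin k → Bool
avoid₂ x y e = not (x == e) ∧ not (y == e)

module SumLemmas {c ℓ} (M : CommutativeMonoid c ℓ) where

  open CommutativeMonoid M
    using (_≈_; _∙_; identityˡ; identityʳ; assoc; comm; ∙-congˡ; ∙-congʳ)
    renaming (Carrier to A; ε to 0#; sym to ≈-sym; trans to ≈-trans; reflexive to ≈-reflexive)
  open CommutativeMonoidSum M public
  open import Relation.Binary.Reasoning.Setoid (CommutativeMonoid.setoid M)

  sum-pick : {k : ℕ} (x : Fin k) (g : Fin k → A) → sum (λ v → if x == v then g v else 0#) ≈ g x
  sum-pick {suc k} zero g = ≈-trans (∙-congˡ (sum-replicate-zero k)) (identityʳ (g zero))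
  sum-pick {suc k} (suc x) g = ≈-trans (identityˡ _) (≈-trans (sum-cong-≋ (λ v → ≈-reflexive (cong (λ b → if b then g (suc v) else 0#) (==-suc x v)))) (sum-pick x (λ v → g (suc v))))

  sum-drop : {k : ℕ} (x : Fin k) (g : Fin k → A) → sum g ≈ sum (λ e → if x == e then 0# else g e) ∙ g x
  sum-drop {k} x g = begin
    sum g                                                               ≈⟨ sum-cong-≋ (λ e → split (x == e) (g e)) ⟩
    sum (λ e → (if x == e then 0# else g e) ∙ (if x == e then g e else 0#)) ≈⟨ ∑-distrib-+ (λ e → if x == e then 0# else g e) (λ e → if x == e then g e else 0#) ⟩
    sum (λ e → if x == e then 0# else g e) ∙ sum (λ e → if x == e then g e else 0#) ≈⟨ ∙-congˡ (sum-pick x g) ⟩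
    sum (λ e → if x == e then 0# else g e) ∙ g x                        ∎
    where
    split : ∀ b y → y ≈ (if b then 0# else y) ∙ (if b then y else 0#)
    split true y = ≈-sym (identityˡ y)
    split false y = ≈-sym (identityʳ y)

  sum-drop₂ : {k : ℕ} (x y : Fin k) → x ≢ y → (g : Fin k → A) →
              sum g ≈ sum (λ e → if avoid₂ x y e then g e else 0#) ∙ g x ∙ g y
  sum-drop₂ x y x≢y g = begin
    sum g                                             ≈⟨ sum-drop x g ⟩
    sum g₁ ∙ g x                                      ≈⟨ ∙-congʳ (sum-drop y g₁) ⟩
    sum (λ e → if y == e then 0# else g₁ e) ∙ g₁ y ∙ g x ≡⟨ cong (λ b → sum (λ e → if y == e then 0# else g₁ e) ∙ (if b then 0# else g y) ∙ g x) (==-≢ x≢y) ⟩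
    sum (λ e → if y == e then 0# else g₁ e) ∙ g y ∙ g x ≈⟨ ∙-congʳ (∙-congʳ (sum-cong-≋ (λ e → ≈-reflexive (both (x == e) (y == e))))) ⟩
    sum (λ e → if avoid₂ x y e then g e else 0#) ∙ g y ∙ g x ≈⟨ assoc _ _ _ ⟩
    sum (λ e → if avoid₂ x y e then g e else 0#) ∙ (g y ∙ g x) ≈⟨ ∙-congˡ (comm _ _) ⟩
    sum (λ e → if avoid₂ x y e then g e else 0#) ∙ (g x ∙ g y) ≈⟨ ≈-sym (assoc _ _ _) ⟩
    sum (λ e → if avoid₂ x y e then g e else 0#) ∙ g x ∙ g y ∎
    where
    g₁ : Fin _ → A
    g₁ e = if x == e then 0# else g e
    both : ∀ (bx by : Bool) {z : A} → (if by then 0# else (if bx then 0# else z)) ≡ (if not bx ∧ not by then z else 0#)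
    both true true = refl
    both true false = refl
    both false true = refl
    both false false = refl

module ℕSum = SumLemmas ℕP.+-0-commutativeMonoid
module ℤSum = SumLemmas ℤP.+-0-commutativeMonoid
module ℕSemiringSum = SemiringSum ℕP.+-*-semiring
module ℤSemiringSum = SemiringSum ℤP.+-*-semiring

count≡sum : (k : ℕ) (b : Fin k → Bool) → count k b ≡ ℕSum.sum (λ i → ind (b i))
count≡sum zero b = refl
count≡sum (suc k) b = cong (ind (b zero) ℕ.+_) (count≡sum k (λ i → b (suc i)))

∑≡sum : (k : ℕ) (g : Fin k → ℤ) → ∑ k g ≡ ℤSum.sum g
∑≡sum zero g = refl
∑≡sum (suc k) g = cong (λ s → g zero ℤ.+ s) (∑≡sum k (λ i → g (suc i)))

∑-+ : (k : ℕ) (g h : Fin k → ℤ) → ∑ k (λ i → g i ℤ.+ h i) ≡ ∑ k g ℤ.+ ∑ k h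
∑-+ k g h = trans (∑≡sum k _) (trans (ℤSum.∑-distrib-+ g h) (sym (cong₂ ℤ._+_ (∑≡sum k g) (∑≡sum k h))))

∑-- : (k : ℕ) (g h : Fin k → ℤ) → ∑ k (λ i → g i ℤ.- h i) ≡ ∑ k g ℤ.- ∑ k h
∑-- zero g h = refl
∑-- (suc k) g h = trans (cong (λ s → g zero ℤ.- h zero ℤ.+ s) (∑-- k (λ i → g (suc i)) (λ i → h (suc i))))
                                (regroup (g zero) (h zero) _ _)
  where
  regroup : ∀ a b c d → a ℤ.- b ℤ.+ (c ℤ.- d) ≡ a ℤ.+ c ℤ.- (b ℤ.+ d)
  regroup = ℤSolver.solve-∀

∑-cong : (k : ℕ) {g h : Fin k → ℤ} → (∀ i → g i ≡ h i) → ∑ k g ≡ ∑ k h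
∑-cong k {g} {h} eq = trans (∑≡sum k g) (trans (ℤSum.sum-cong-≋ eq) (sym (∑≡sum k h)))

∑-*ˡ : (k : ℕ) (a : ℤ) (g : Fin k → ℤ) → ∑ k (λ i → a ℤ.* g i) ≡ a ℤ.* ∑ k g
∑-*ˡ k a g = trans (∑≡sum k _) (trans (sym (ℤSemiringSum.*-distribˡ-sum a g)) (cong (a ℤ.*_) (sym (∑≡sum k g))))

∑-zero : (k : ℕ) → ∑ k (λ _ → + 0) ≡ + 0
∑-zero k = trans (∑≡sum k _) (ℤSum.sum-replicate-zero k)

count-∑ : (k : ℕ) (b : Fin k → Bool) → + count k b ≡ ∑ k (λ i → indℤ (b i))
count-∑ zero b = refl
count-∑ (suc k) b = trans (ℤP.pos-+ (ind (b zero)) _) (cong (λ s → indℤ (b zero) ℤ.+ s) (count-∑ k (λ i → b (suc i))))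

∣-∑ : {d : ℤ} (k : ℕ) (g : Fin k → ℤ) → (∀ i → d ℤD.∣ g i) → d ℤD.∣ ∑ k g
∣-∑ zero g h = divides (+ 0) refl
∣-∑ (suc k) g h = ℤD.∣m∣n⇒∣m+n (h zero) (∣-∑ k (λ i → g (suc i)) (λ i → h (suc i)))

-- Parity and signs

oddᵇ : ℕ → Bool
oddᵇ zero = false
oddᵇ (suc k) = not (oddᵇ k)

oddᵇ-+ : (a b : ℕ) → oddᵇ (a + b) ≡ oddᵇ a xor oddᵇ b
oddᵇ-+ zero b = refl
oddᵇ-+ (suc a) b = trans (cong not (oddᵇ-+ a b)) (not-distribˡ-xor (oddᵇ a) (oddᵇ b))

oddᵇ-ind : (b : Bool) → oddᵇ (ind b) ≡ b
oddᵇ-ind true = refl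
oddᵇ-ind false = refl

even⇒¬oddᵇ : (a : ℕ) → EvenNat a → oddᵇ a ≡ false
even⇒¬oddᵇ a (divides q refl) = double q
  where
  double : ∀ q → oddᵇ (q * 2) ≡ false
  double zero = refl
  double (suc q) = trans (not-involutive _) (double q)

odd-1 : OddNat 1
odd-1 (divides zero ())
odd-1 (divides (suc q) ())

even-double : (a : ℕ) → EvenNat (a + a)
even-double a = divides a (solve a)
  where
  solve : ∀ a → a + a ≡ a * 2
  solve a = trans (cong (a ℕ.+_) (sym (ℕP.+-identityʳ a))) (ℕP.*-comm 2 a)

oddℤ-split : (z : ℤ) → ∃ λ q → z ≡ + 2 ℤ.* q ℤ.+ indℤ (oddℤ z)
oddℤ-split (+ k) = + (k / 2) , trans (cong +_ (ℕ-split k)) (toℤ (ind (k % 2 ℕ.≡ᵇ 1)) (k / 2))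
  where
  toℤ : ∀ r q → + (r + q * 2) ≡ + 2 ℤ.* + q ℤ.+ + r
  toℤ r q = trans (ℤP.pos-+ r (q * 2)) (trans (cong (λ x → + r ℤ.+ x) (ℤP.pos-* q 2)) (lemma (+ r) (+ q)))
    where
    lemma : ∀ (x y : ℤ) → x ℤ.+ y ℤ.* + 2 ≡ + 2 ℤ.* y ℤ.+ x
    lemma = ℤSolver.solve-∀
  ℕ-split : ∀ k → k ≡ ind (k % 2 ℕ.≡ᵇ 1) + (k / 2) * 2
  ℕ-split k with k % 2 | m≡m%n+[m/n]*n k 2 | m%n<n k 2
  ... | 0 | eq | _ = eq
  ... | 1 | eq | _ = eq
  ... | suc (suc _) | _ | ℕ.s≤s (ℕ.s≤s ())
oddℤ-split -[1+ k ] with oddℤ-split (+ suc k)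
... | q , eq = - q ℤ.- r , trans (cong -_ eq) (lemma q r)
  where
  r = indℤ (oddℤ (+ suc k))
  lemma : ∀ (q r : ℤ) → - (+ 2 ℤ.* q ℤ.+ r) ≡ + 2 ℤ.* (- q ℤ.- r) ℤ.+ r
  lemma = ℤSolver.solve-∀

even-oddℤ-split : (z : ℤ) → oddℤ z ≡ false → ∃ λ q → z ≡ + 2 ℤ.* q
even-oddℤ-split z ev with oddℤ-split z
... | q , eq = q , trans eq (trans (cong (λ b → + 2 ℤ.* q ℤ.+ indℤ b) ev) (ℤP.+-identityʳ _))

ℤ-even⇒even : (a : ℕ) → + 2 ℤD.∣ + a → EvenNat a
ℤ-even⇒even a h = ℤD.∣⇒∣ᵤ h

negate : Sign → Sign
negate plus = minus
negate minus = plus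

_·_ : Sign → Sign → Sign
plus · s = s
minus · s = negate s

⟦·⟧ : (s t : Sign) → ⟦ s · t ⟧ ≡ ⟦ s ⟧ ℤ.* ⟦ t ⟧
⟦·⟧ plus plus = refl
⟦·⟧ plus minus = refl
⟦·⟧ minus plus = refl
⟦·⟧ minus minus = refl

isNeg-· : (s t : Sign) → isNeg (s · t) ≡ isNeg s xor isNeg t
isNeg-· plus t = refl
isNeg-· minus plus = refl
isNeg-· minus minus = refl

signOf : Bool → Sign
signOf true = minus
signOf false = plus

isNeg-signOf : (b : Bool) → isNeg (signOf b) ≡ b
isNeg-signOf true = refl
isNeg-signOf false = refl

isNeg-orientation : (t₀ t₁ σ : Sign) → ⟦ t₀ ⟧ ℤ.* ⟦ t₁ ⟧ ≡ - ⟦ σ ⟧ → (isNeg t₀ xor isNeg t₁) ≡ not (isNeg σ)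
isNeg-orientation plus plus plus ()
isNeg-orientation plus plus minus _ = refl
isNeg-orientation plus minus plus _ = refl
isNeg-orientation plus minus minus ()
isNeg-orientation minus plus plus _ = refl
isNeg-orientation minus plus minus ()
isNeg-orientation minus minus plus ()
isNeg-orientation minus minus minus _ = refl

-- Flow conservation modulo 4 under switching

sign-pair-mod4 : (p q : Sign) (x : ℤ) →
                 + 4 ℤD.∣ (⟦ p ⟧ ℤ.+ ⟦ q ⟧) ℤ.* x ℤ.- + 2 ℤ.* indℤ (oddℤ x ∧ not (isNeg p xor isNeg q))
sign-pair-mod4 p q x with oddℤ-split x
... | k , x≡ = subst (λ y → + 4 ℤD.∣ (⟦ p ⟧ ℤ.+ ⟦ q ⟧) ℤ.* y ℤ.- + 2 ℤ.* indℤ (oddℤ x ∧ not (isNeg p xor isNeg q))) (sym x≡) (lemma p q)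
  where
  r = indℤ (oddℤ x)
  lemma : ∀ p q → + 4 ℤD.∣ (⟦ p ⟧ ℤ.+ ⟦ q ⟧) ℤ.* (+ 2 ℤ.* k ℤ.+ r) ℤ.- + 2 ℤ.* indℤ (oddℤ x ∧ not (isNeg p xor isNeg q))
  lemma plus plus rewrite ∧-identityʳ (oddℤ x) = divides k (eq k r)
    where
    eq : ∀ k r → (+ 1 ℤ.+ + 1) ℤ.* (+ 2 ℤ.* k ℤ.+ r) ℤ.- + 2 ℤ.* r ≡ k ℤ.* + 4
    eq = ℤSolver.solve-∀
  lemma plus minus rewrite ∧-zeroʳ (oddℤ x) = divides (+ 0) (eq k r)
    where
    eq : ∀ k r → (+ 1 ℤ.+ - + 1) ℤ.* (+ 2 ℤ.* k ℤ.+ r) ℤ.- + 2 ℤ.* + 0 ≡ + 0 ℤ.* + 4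
    eq = ℤSolver.solve-∀
  lemma minus plus rewrite ∧-zeroʳ (oddℤ x) = divides (+ 0) (eq k r)
    where
    eq : ∀ k r → (- + 1 ℤ.+ + 1) ℤ.* (+ 2 ℤ.* k ℤ.+ r) ℤ.- + 2 ℤ.* + 0 ≡ + 0 ℤ.* + 4
    eq = ℤSolver.solve-∀
  lemma minus minus rewrite ∧-identityʳ (oddℤ x) = divides (- k ℤ.- r) (eq k r)
    where
    eq : ∀ k r → (- + 1 ℤ.+ - + 1) ℤ.* (+ 2 ℤ.* k ℤ.+ r) ℤ.- + 2 ℤ.* r ≡ (- k ℤ.- r) ℤ.* + 4
    eq = ℤSolver.solve-∀

sign-even-mod4 : (p : Sign) (x : ℤ) → oddℤ x ≡ false → + 4 ℤD.∣ ⟦ p ⟧ ℤ.* x ℤ.- x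
sign-even-mod4 p x ev with even-oddℤ-split x ev
... | k , refl = lemma p
  where
  lemma : ∀ p → + 4 ℤD.∣ ⟦ p ⟧ ℤ.* (+ 2 ℤ.* k) ℤ.- + 2 ℤ.* k
  lemma plus = divides (+ 0) (eq k)
    where
    eq : ∀ k → + 1 ℤ.* (+ 2 ℤ.* k) ℤ.- + 2 ℤ.* k ≡ + 0 ℤ.* + 4
    eq = ℤSolver.solve-∀
  lemma minus = divides (- k) (eq k)
    where
    eq : ∀ k → - + 1 ℤ.* (+ 2 ℤ.* k) ℤ.- + 2 ℤ.* k ≡ - k ℤ.* + 4
    eq = ℤSolver.solve-∀

switched : Sign → Sign → Sign → Sign
switched s₀ s₁ σ = s₀ · (s₁ · σ)

isNeg-switched-signOf : (a b : Bool) (σ : Sign) → isNeg (switched (signOf a) (signOf b) σ) ≡ (a xor b) xor isNeg σ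
isNeg-switched-signOf a b σ = begin
  isNeg (signOf a · (signOf b · σ))                 ≡⟨ trans (isNeg-· (signOf a) (signOf b · σ)) (cong (isNeg (signOf a) xor_) (isNeg-· (signOf b) σ)) ⟩
  isNeg (signOf a) xor (isNeg (signOf b) xor isNeg σ) ≡⟨ cong₂ (λ x y → x xor (y xor isNeg σ)) (isNeg-signOf a) (isNeg-signOf b) ⟩
  a xor (b xor isNeg σ)                             ≡⟨ sym (xor-assoc a b (isNeg σ)) ⟩
  (a xor b) xor isNeg σ                             ∎
  where open ≡-Reasoning

weight : Bool → Sign → ℤ
weight u s = if u then ⟦ s ⟧ else + 0

module XorSemigroup = Algebra.Properties.CommutativeSemigroup (CommutativeMonoid.commutativeSemigroup (CommutativeRing.+-commutativeMonoid xor-∧-commutativeRing))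

isNeg-switched : (s₀ s₁ t₀ t₁ σ : Sign) → ⟦ t₀ ⟧ ℤ.* ⟦ t₁ ⟧ ≡ - ⟦ σ ⟧ →
                 isNeg (switched s₀ s₁ σ) ≡ not (isNeg (s₀ · t₀) xor isNeg (s₁ · t₁))
isNeg-switched s₀ s₁ t₀ t₁ σ or = begin
  isNeg (s₀ · (s₁ · σ))                          ≡⟨ trans (isNeg-· s₀ (s₁ · σ)) (cong (isNeg s₀ xor_) (isNeg-· s₁ σ)) ⟩
  isNeg s₀ xor (isNeg s₁ xor isNeg σ)            ≡⟨ sym (xor-assoc (isNeg s₀) (isNeg s₁) (isNeg σ)) ⟩
  (isNeg s₀ xor isNeg s₁) xor isNeg σ            ≡⟨ cong ((isNeg s₀ xor isNeg s₁) xor_) (sym (not-involutive (isNeg σ))) ⟩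
  (isNeg s₀ xor isNeg s₁) xor not (not (isNeg σ)) ≡⟨ sym (not-distribʳ-xor (isNeg s₀ xor isNeg s₁) (not (isNeg σ))) ⟩
  not ((isNeg s₀ xor isNeg s₁) xor not (isNeg σ)) ≡⟨ cong (λ b → not ((isNeg s₀ xor isNeg s₁) xor b)) (sym (isNeg-orientation t₀ t₁ σ or)) ⟩
  not ((isNeg s₀ xor isNeg s₁) xor (isNeg t₀ xor isNeg t₁)) ≡⟨ cong not (XorSemigroup.interchange (isNeg s₀) (isNeg s₁) (isNeg t₀) (isNeg t₁)) ⟩
  not ((isNeg s₀ xor isNeg t₀) xor (isNeg s₁ xor isNeg t₁)) ≡⟨ cong₂ (λ a b → not (a xor b)) (sym (isNeg-· s₀ t₀)) (sym (isNeg-· s₁ t₁)) ⟩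
  not (isNeg (s₀ · t₀) xor isNeg (s₁ · t₁))      ∎
  where
  open ≡-Reasoning

edge-mod4 : (u₀ u₁ : Bool) (s₀ s₁ t₀ t₁ σ : Sign) (x : ℤ) → ⟦ t₀ ⟧ ℤ.* ⟦ t₁ ⟧ ≡ - ⟦ σ ⟧ →
            (T (u₀ xor u₁) → oddℤ x ≡ false) →
            + 4 ℤD.∣ (weight u₀ s₀ ℤ.* ⟦ t₀ ⟧ ℤ.+ weight u₁ s₁ ℤ.* ⟦ t₁ ⟧) ℤ.* x
                     ℤ.- (+ 2 ℤ.* indℤ (oddℤ x ∧ u₀ ∧ u₁ ∧ isNeg (switched s₀ s₁ σ)) ℤ.+ (if u₀ xor u₁ then x else + 0))
edge-mod4 true true s₀ s₁ t₀ t₁ σ x or _ =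
  subst (+ 4 ℤD.∣_) (cong₂ (λ a b → a ℤ.* x ℤ.- b) (cong₂ ℤ._+_ (⟦·⟧ s₀ t₀) (⟦·⟧ s₁ t₁))
                      (trans (cong (λ b → + 2 ℤ.* indℤ (oddℤ x ∧ b)) (sym (isNeg-switched s₀ s₁ t₀ t₁ σ or))) (sym (ℤP.+-identityʳ _))))
    (sign-pair-mod4 (s₀ · t₀) (s₁ · t₁) x)
edge-mod4 true false s₀ s₁ t₀ t₁ σ x _ even rewrite ∧-zeroʳ (oddℤ x) =
  subst (+ 4 ℤD.∣_) (trans (cong (λ a → a ℤ.* x ℤ.- x) (⟦·⟧ s₀ t₀)) (eq ⟦ s₀ ⟧ ⟦ t₀ ⟧ ⟦ t₁ ⟧ x)) (sign-even-mod4 (s₀ · t₀) x (even tt))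
  where
  eq : ∀ a b c x → a ℤ.* b ℤ.* x ℤ.- x ≡ (a ℤ.* b ℤ.+ + 0 ℤ.* c) ℤ.* x ℤ.- (+ 2 ℤ.* + 0 ℤ.+ x)
  eq = ℤSolver.solve-∀
edge-mod4 false true s₀ s₁ t₀ t₁ σ x _ even rewrite ∧-zeroʳ (oddℤ x) =
  subst (+ 4 ℤD.∣_) (trans (cong (λ a → a ℤ.* x ℤ.- x) (⟦·⟧ s₁ t₁)) (eq ⟦ s₁ ⟧ ⟦ t₁ ⟧ ⟦ t₀ ⟧ x)) (sign-even-mod4 (s₁ · t₁) x (even tt))
  where
  eq : ∀ a b c x → a ℤ.* b ℤ.* x ℤ.- x ≡ (+ 0 ℤ.* c ℤ.+ a ℤ.* b) ℤ.* x ℤ.- (+ 2 ℤ.* + 0 ℤ.+ x)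
  eq = ℤSolver.solve-∀
edge-mod4 false false s₀ s₁ t₀ t₁ σ x _ _ rewrite ∧-zeroʳ (oddℤ x) = divides (+ 0) (eq ⟦ t₀ ⟧ ⟦ t₁ ⟧ x)
  where
  eq : ∀ a b x → (+ 0 ℤ.* a ℤ.+ + 0 ℤ.* b) ℤ.* x ℤ.- (+ 2 ℤ.* + 0 ℤ.+ + 0) ≡ + 0 ℤ.* + 4
  eq = ℤSolver.solve-∀

module _ (G : SignedGraph) (τ : Orientation G) (f : Fin (m G) → ℤ) where

  open ℤSum using (sum; sum-cong-≋; ∑-comm; sum-pick)

  boundary-weighted : (c : Fin (n G) → ℤ) →
    ∑ (n G) (λ v → c v ℤ.* boundary G all τ f v) ≡
    ∑ (m G) (λ e → (c (src G e) ℤ.* ⟦ τ e false ⟧ ℤ.+ c (tgt G e) ℤ.* ⟦ τ e true ⟧) ℤ.* f e)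
  boundary-weighted c = begin
    ∑ (n G) (λ v → c v ℤ.* boundary G all τ f v)         ≡⟨ ∑≡sum (n G) _ ⟩
    sum (λ v → c v ℤ.* ∑ (m G) (λ e → H v e))             ≡⟨ sum-cong-≋ (λ v → cong (c v ℤ.*_) (∑≡sum (m G) (H v))) ⟩
    sum (λ v → c v ℤ.* sum (λ e → H v e))                 ≡⟨ sum-cong-≋ (λ v → ℤSemiringSum.*-distribˡ-sum (c v) (H v)) ⟩
    sum (λ v → sum (λ e → c v ℤ.* H v e))                 ≡⟨ ∑-comm (λ v e → c v ℤ.* H v e) ⟩
    sum (λ e → sum (λ v → c v ℤ.* H v e))                 ≡⟨ sum-cong-≋ per-edge ⟩
    sum (λ e → (c (src G e) ℤ.* ⟦ τ e false ⟧ ℤ.+ c (tgt G e) ℤ.* ⟦ τ e true ⟧) ℤ.* f e) ≡⟨ sym (∑≡sum (m G) _) ⟩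
    ∑ (m G) (λ e → (c (src G e) ℤ.* ⟦ τ e false ⟧ ℤ.+ c (tgt G e) ℤ.* ⟦ τ e true ⟧) ℤ.* f e) ∎
    where
    open ≡-Reasoning
    H : Fin (n G) → Fin (m G) → ℤ
    H v e = half G τ f v e false ℤ.+ half G τ f v e true
    at-end : ∀ e b → sum (λ v → c v ℤ.* half G τ f v e b) ≡ c (endOf G e b) ℤ.* (⟦ τ e b ⟧ ℤ.* f e)
    at-end e b = trans (sum-cong-≋ (λ v → push (endOf G e b == v) (c v)))
                       (sum-pick (endOf G e b) (λ v → c v ℤ.* (⟦ τ e b ⟧ ℤ.* f e)))
      where
      push : ∀ b′ x → x ℤ.* (if b′ then ⟦ τ e b ⟧ ℤ.* f e else + 0) ≡ (if b′ then x ℤ.* (⟦ τ e b ⟧ ℤ.* f e) else + 0)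
      push true x = refl
      push false x = ℤP.*-zeroʳ x
    per-edge : ∀ e → sum (λ v → c v ℤ.* H v e) ≡ (c (src G e) ℤ.* ⟦ τ e false ⟧ ℤ.+ c (tgt G e) ℤ.* ⟦ τ e true ⟧) ℤ.* f e
    per-edge e = begin
      sum (λ v → c v ℤ.* H v e)   ≡⟨ sum-cong-≋ (λ v → ℤP.*-distribˡ-+ (c v) _ _) ⟩
      sum (λ v → c v ℤ.* half G τ f v e false ℤ.+ c v ℤ.* half G τ f v e true)
        ≡⟨ ℤSum.∑-distrib-+ (λ v → c v ℤ.* half G τ f v e false) (λ v → c v ℤ.* half G τ f v e true) ⟩
      sum (λ v → c v ℤ.* half G τ f v e false) ℤ.+ sum (λ v → c v ℤ.* half G τ f v e true)
        ≡⟨ cong₂ ℤ._+_ (at-end e false) (at-end e true) ⟩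
      c (src G e) ℤ.* (⟦ τ e false ⟧ ℤ.* f e) ℤ.+ c (tgt G e) ℤ.* (⟦ τ e true ⟧ ℤ.* f e)
        ≡⟨ factor (c (src G e)) (c (tgt G e)) ⟦ τ e false ⟧ ⟦ τ e true ⟧ (f e) ⟩
      (c (src G e) ℤ.* ⟦ τ e false ⟧ ℤ.+ c (tgt G e) ℤ.* ⟦ τ e true ⟧) ℤ.* f e ∎
      where
      factor : ∀ a b s t x → a ℤ.* (s ℤ.* x) ℤ.+ b ℤ.* (t ℤ.* x) ≡ (a ℤ.* s ℤ.+ b ℤ.* t) ℤ.* x
      factor = ℤSolver.solve-∀

  OddNegIn : (Fin (n G) → Bool) → (Fin (n G) → Sign) → Fin (m G) → Bool
  OddNegIn U s e = oddℤ (f e) ∧ U (src G e) ∧ U (tgt G e) ∧ isNeg (switched (s (src G e)) (s (tgt G e)) (σ G e))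

  oddNegCount : (Fin (n G) → Bool) → (Fin (n G) → Sign) → ℕ
  oddNegCount U s = count (m G) (OddNegIn U s)

  crossFlow : (Fin (n G) → Bool) → Fin (m G) → ℤ
  crossFlow U e = if U (src G e) xor U (tgt G e) then f e else + 0

  NoOddCrossing : (Fin (n G) → Bool) → Set
  NoOddCrossing U = ∀ e → T (U (src G e) xor U (tgt G e)) → oddℤ (f e) ≡ false

  module _ (or : IsOrientationOn G all τ) (flow : ∀ v → boundary G all τ f v ≡ + 0) where

    -- Weighting the flow conservation at v by ±1 (the switching s) on U and 0 elsewhere.
    oddNegCount-mod4 : (U : Fin (n G) → Bool) (s : Fin (n G) → Sign) → NoOddCrossing U →
                       + 4 ℤD.∣ + 2 ℤ.* + oddNegCount U s ℤ.+ ∑ (m G) (crossFlow U)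
    oddNegCount-mod4 U s noCross = subst (+ 4 ℤD.∣_) total (ℤD.∣m⇒∣-m (∣-∑ (m G) _ per-edge))
      where
      w : Fin (n G) → ℤ
      w v = weight (U v) (s v)
      κf : Fin (m G) → ℤ
      κf e = (w (src G e) ℤ.* ⟦ τ e false ⟧ ℤ.+ w (tgt G e) ℤ.* ⟦ τ e true ⟧) ℤ.* f e
      r : Fin (m G) → ℤ
      r e = + 2 ℤ.* indℤ (OddNegIn U s e) ℤ.+ crossFlow U e
      per-edge : ∀ e → + 4 ℤD.∣ κf e ℤ.- r e
      per-edge e = edge-mod4 (U (src G e)) (U (tgt G e)) (s (src G e)) (s (tgt G e)) (τ e false) (τ e true) (σ G e) (f e)
                             (or e tt) (noCross e)
      ∑κf : ∑ (m G) κf ≡ + 0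
      ∑κf = begin
        ∑ (m G) κf                                    ≡⟨ sym (boundary-weighted w) ⟩
        ∑ (n G) (λ v → w v ℤ.* boundary G all τ f v)  ≡⟨ ∑-cong (n G) (λ v → trans (cong (w v ℤ.*_) (flow v)) (ℤP.*-zeroʳ (w v))) ⟩
        ∑ (n G) (λ _ → + 0)                           ≡⟨ ∑-zero (n G) ⟩
        + 0                                           ∎
        where open ≡-Reasoning
      total : - ∑ (m G) (λ e → κf e ℤ.- r e) ≡ + 2 ℤ.* + oddNegCount U s ℤ.+ ∑ (m G) (crossFlow U)
      total = begin
        - ∑ (m G) (λ e → κf e ℤ.- r e)          ≡⟨ cong -_ (∑-- (m G) κf r) ⟩
        - (∑ (m G) κf ℤ.- ∑ (m G) r)            ≡⟨ cong (λ a → - (a ℤ.- ∑ (m G) r)) ∑κf ⟩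
        - (+ 0 ℤ.- ∑ (m G) r)                   ≡⟨ trans (cong -_ (ℤP.+-identityˡ (- ∑ (m G) r))) (ℤP.neg-involutive (∑ (m G) r)) ⟩
        ∑ (m G) r                               ≡⟨ ∑-+ (m G) _ _ ⟩
        ∑ (m G) (λ e → + 2 ℤ.* indℤ (OddNegIn U s e)) ℤ.+ ∑ (m G) (crossFlow U)
          ≡⟨ cong (ℤ._+ ∑ (m G) (crossFlow U)) (trans (∑-*ˡ (m G) (+ 2) _) (cong (+ 2 ℤ.*_) (sym (count-∑ (m G) (OddNegIn U s))))) ⟩
        + 2 ℤ.* + oddNegCount U s ℤ.+ ∑ (m G) (crossFlow U) ∎
        where open ≡-Reasoning

    private
      halve : {a : ℤ} → + 4 ℤD.∣ + 2 ℤ.* a → + 2 ℤD.∣ a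
      halve {a} h = ℤD.*-cancelˡ-∣ (+ 2) h

    oddNegCount-even-if-closed : (U : Fin (n G) → Bool) (s : Fin (n G) → Sign) →
                                 (∀ e → U (src G e) ≡ U (tgt G e)) → EvenNat (oddNegCount U s)
    oddNegCount-even-if-closed U s closed =
      ℤ-even⇒even (oddNegCount U s) (halve (subst (+ 4 ℤD.∣_) noFlowAcross (oddNegCount-mod4 U s noCross)))
      where
      xor-self : ∀ e → (U (src G e) xor U (tgt G e)) ≡ false
      xor-self e = trans (cong (_xor U (tgt G e)) (closed e)) (xor-same (U (tgt G e)))
      noCross : NoOddCrossing U
      noCross e h = ⊥-elim (subst T (xor-self e) h)
      noFlowAcross : + 2 ℤ.* + oddNegCount U s ℤ.+ ∑ (m G) (crossFlow U) ≡ + 2 ℤ.* + oddNegCount U s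
      noFlowAcross = trans (cong (λ c → + 2 ℤ.* + oddNegCount U s ℤ.+ c)
                              (trans (∑-cong (m G) (λ e → cong (λ b → if b then f e else + 0) (xor-self e))) (∑-zero (m G))))
                           (ℤP.+-identityʳ _)

    oddNegCount-parity-switch : (U : Fin (n G) → Bool) → NoOddCrossing U → (s₁ s₂ : Fin (n G) → Sign) →
                                EvenNat (oddNegCount U s₁) → EvenNat (oddNegCount U s₂)
    oddNegCount-parity-switch U noCross s₁ s₂ even₁ =
      ℤ-even⇒even N₂ (subst (+ 2 ℤD.∣_) (cancel (+ N₁) (+ N₂)) (ℤD.∣m∣n⇒∣m-n (ℤD.∣ᵤ⇒∣ {k = + 2} {i = + N₁} even₁) (halve difference)))
      where
      N₁ = oddNegCount U s₁
      N₂ = oddNegCount U s₂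
      C = ∑ (m G) (crossFlow U)
      difference : + 4 ℤD.∣ + 2 ℤ.* (+ N₁ ℤ.- + N₂)
      difference = subst (+ 4 ℤD.∣_) (regroup (+ N₁) (+ N₂) C) (ℤD.∣m∣n⇒∣m-n (oddNegCount-mod4 U s₁ noCross) (oddNegCount-mod4 U s₂ noCross))
        where
        regroup : ∀ a b c → (+ 2 ℤ.* a ℤ.+ c) ℤ.- (+ 2 ℤ.* b ℤ.+ c) ≡ + 2 ℤ.* (a ℤ.- b)
        regroup = ℤSolver.solve-∀
      cancel : ∀ a b → a ℤ.- (a ℤ.- b) ≡ b
      cancel = ℤSolver.solve-∀

-- Walks and reachability

sumTo : ℕ → (ℕ → ℕ) → ℕ
sumTo zero g = 0
sumTo (suc k) g = g 0 + sumTo k (λ t → g (suc t))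

sumTo-cong : (k : ℕ) {g h : ℕ → ℕ} → (∀ t → t < k → g t ≡ h t) → sumTo k g ≡ sumTo k h
sumTo-cong zero eq = refl
sumTo-cong (suc k) eq = cong₂ _+_ (eq 0 (s≤s z≤n)) (sumTo-cong k (λ t t<k → eq (suc t) (s≤s t<k)))

sumTo-+ : (a b : ℕ) (g : ℕ → ℕ) → sumTo (a + b) g ≡ sumTo a g + sumTo b (λ t → g (a + t))
sumTo-+ zero b g = refl
sumTo-+ (suc a) b g = trans (cong (λ y → g 0 + y) (sumTo-+ a b (λ t → g (suc t)))) (sym (ℕP.+-assoc (g 0) _ _))

sumTo-reverse : (k : ℕ) (g : ℕ → ℕ) → sumTo k (λ t → g (k ∸ suc t)) ≡ sumTo k g
sumTo-reverse zero g = refl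
sumTo-reverse (suc k) g = begin
  g k + sumTo k (λ t → g (k ∸ suc t)) ≡⟨ cong (λ y → g k + y) (sumTo-reverse k g) ⟩
  g k + sumTo k g                     ≡⟨ ℕP.+-comm (g k) (sumTo k g) ⟩
  sumTo k g + g k                     ≡⟨ cong (λ y → sumTo k g + y) (sym (trans (ℕP.+-identityʳ _) (cong g (ℕP.+-identityʳ k)))) ⟩
  sumTo k g + sumTo 1 (λ t → g (k + t)) ≡⟨ sym (sumTo-+ k 1 g) ⟩
  sumTo (k + 1) g                     ≡⟨ cong (λ j → sumTo j g) (ℕP.+-comm k 1) ⟩
  sumTo (suc k) g                     ∎
  where open ≡-Reasoning

below : {X : Set} → ℕ → ℕ → X → X → X
below t i a b = if t <ᵇ i then a else b

below-< : {X : Set} {t i : ℕ} {a b : X} → t < i → below t i a b ≡ a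
below-< {t = t} {i} lt with t <ᵇ i | ℕP.<⇒<ᵇ lt
... | true | _ = refl

below-≥ : {X : Set} {t i : ℕ} {a b : X} → i ≤ t → below t i a b ≡ b
below-≥ {t = t} {i} ge with t <ᵇ i in eq
... | true = ⊥-elim (ℕP.<⇒≱ (ℕP.<ᵇ⇒< t i (subst T (sym eq) tt)) ge)
... | false = refl

Joins-sym : {G : SignedGraph} {e : Fin (m G)} {x y : Fin (n G)} → Joins G e x y → Joins G e y x
Joins-sym (inj₁ (p , q)) = inj₂ (p , q)
Joins-sym (inj₂ (p , q)) = inj₁ (p , q)

Injective≤ : {V : Set} → ℕ → (ℕ → V) → Set
Injective≤ bound f = ∀ i j → i < j → j ≤ bound → f i ≢ f j

-- Vertices and edges are indexed by ℕ; positions beyond `steps` are junk.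
record Walk (G : SignedGraph) (S : Fin (m G) → Bool) : Set where
  field
    steps  : ℕ
    vertex : ℕ → Fin (n G)
    edge   : ℕ → Fin (m G)
    valid  : ∀ t → t < steps → T (S (edge t)) × Joins G (edge t) (vertex t) (vertex (suc t))

open Walk public

module _ {G : SignedGraph} {S : Fin (m G) → Bool} where

  first last : Walk G S → Fin (n G)
  first W = vertex W 0
  last W = vertex W (steps W)

  negCount : Walk G S → ℕ
  negCount W = sumTo (steps W) (λ t → ind (isNeg (σ G (edge W t))))

  AllVertices : (Fin (n G) → Set) → Walk G S → Set
  AllVertices P W = ∀ t → t ≤ steps W → P (vertex W t)

  Distinct : Walk G S → Set
  Distinct W = Injective≤ (steps W) (vertex W)

  trivialWalk : Fin (n G) → Fin (m G) → Walk G S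
  trivialWalk v e = record { steps = 0 ; vertex = λ _ → v ; edge = λ _ → e ; valid = λ _ () }

  edgeWalk : (e : Fin (m G)) {x y : Fin (n G)} → T (S e) → Joins G e x y → Walk G S
  edgeWalk e {x} {y} s j = record
    { steps = 1 ; vertex = λ t → below t 1 x y ; edge = λ _ → e
    ; valid = λ { zero _ → s , j ; (suc t) (s≤s ()) } }

  reverse : Walk G S → Walk G S
  reverse W = record
    { steps = steps W ; vertex = λ t → vertex W (steps W ∸ t) ; edge = λ t → edge W (steps W ∸ suc t)
    ; valid = λ t t< → let k = steps W ∸ suc t
                           k+1≡ : steps W ∸ t ≡ suc k
                           k+1≡ = ℕP.+-∸-assoc 1 t<
                           (s , j) = valid W k (ℕP.≤-trans (ℕP.≤-reflexive (sym k+1≡)) (ℕP.m∸n≤m (steps W) t))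
                       in s , subst (λ z → Joins G (edge W k) z (vertex W (steps W ∸ suc t))) (cong (vertex W) (sym k+1≡)) (Joins-sym {G} j) }

  reverse-last : (W : Walk G S) → last (reverse W) ≡ first W
  reverse-last W = cong (vertex W) (ℕP.n∸n≡0 (steps W))

  reverse-negCount : (W : Walk G S) → negCount (reverse W) ≡ negCount W
  reverse-negCount W = sumTo-reverse (steps W) (λ t → ind (isNeg (σ G (edge W t))))

  reverse-AllVertices : (P : Fin (n G) → Set) (W : Walk G S) → AllVertices P W → AllVertices P (reverse W)
  reverse-AllVertices P W all t _ = all (steps W ∸ t) (ℕP.m∸n≤m (steps W) t)

  prefix : (W : Walk G S) (k : ℕ) → k ≤ steps W → Walk G S
  prefix W k k≤ = record { steps = k ; vertex = vertex W ; edge = edge W ; valid = λ t t< → valid W t (ℕP.<-≤-trans t< k≤) }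

  drop : (k : ℕ) → Walk G S → Walk G S
  drop k W = record
    { steps = steps W ∸ k ; vertex = λ t → vertex W (k + t) ; edge = λ t → edge W (k + t)
    ; valid = λ t t< → subst (λ z → T (S (edge W (k + t))) × Joins G (edge W (k + t)) (vertex W (k + t)) (vertex W z))
                             (sym (ℕP.+-suc k t)) (valid W (k + t) (shift t t<)) }
    where
    shift : ∀ t → t < steps W ∸ k → k + t < steps W
    shift t t< = ℕP.<-≤-trans (ℕP.+-monoʳ-< k t<) (ℕP.≤-reflexive (ℕP.m+[n∸m]≡n k≤))
      where
      k≤ : k ≤ steps W
      k≤ = ℕP.<⇒≤ (ℕP.m∸n≢0⇒n<m (λ eq → ℕP.n≮0 (subst (t <_) eq t<)))

  drop-first : (k : ℕ) (W : Walk G S) → first (drop k W) ≡ vertex W k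
  drop-first k W = cong (vertex W) (ℕP.+-identityʳ k)

  drop-last : (k : ℕ) (W : Walk G S) → k ≤ steps W → last (drop k W) ≡ last W
  drop-last k W k≤ = cong (vertex W) (ℕP.m+[n∸m]≡n k≤)

  negCount-split : (W : Walk G S) (k : ℕ) (k≤ : k ≤ steps W) → negCount W ≡ negCount (prefix W k k≤) + negCount (drop k W)
  negCount-split W k k≤ = trans (cong (λ j → sumTo j g) (sym (ℕP.m+[n∸m]≡n k≤))) (sumTo-+ k (steps W ∸ k) g)
    where
    g : ℕ → ℕ
    g t = ind (isNeg (σ G (edge W t)))

  module Concat (W₁ W₂ : Walk G S) (meet : last W₁ ≡ first W₂) where

    private
      l₁ = steps W₁

    vert : ℕ → Fin (n G)
    vert t = below t l₁ (vertex W₁ t) (vertex W₂ (t ∸ l₁))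

    edg : ℕ → Fin (m G)
    edg t = below t l₁ (edge W₁ t) (edge W₂ (t ∸ l₁))

    vert-left : ∀ t → t ≤ l₁ → vert t ≡ vertex W₁ t
    vert-left t t≤ with ℕP.m≤n⇒m<n∨m≡n t≤
    ... | inj₁ t< = below-< t<
    ... | inj₂ refl = trans (below-≥ {t = t} {t} ℕP.≤-refl) (trans (cong (vertex W₂) (ℕP.n∸n≡0 t)) (sym meet))

    vert-right : ∀ u → vert (l₁ + u) ≡ vertex W₂ u
    vert-right u = trans (below-≥ (ℕP.m≤m+n l₁ u)) (cong (vertex W₂) (ℕP.m+n∸m≡n l₁ u))

    edg-left : ∀ t → t < l₁ → edg t ≡ edge W₁ t
    edg-left t t< = below-< t<

    edg-right : ∀ u → edg (l₁ + u) ≡ edge W₂ u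
    edg-right u = trans (below-≥ (ℕP.m≤m+n l₁ u)) (cong (edge W₂) (ℕP.m+n∸m≡n l₁ u))

    Step : ℕ → Set
    Step t = T (S (edg t)) × Joins G (edg t) (vert t) (vert (suc t))

    valid-left : ∀ t → t < l₁ → Step t
    valid-left t t< rewrite edg-left t t< | vert-left t (ℕP.<⇒≤ t<) | vert-left (suc t) t< = valid W₁ t t<

    valid-right : ∀ u → u < steps W₂ → Step (l₁ + u)
    valid-right u u< rewrite edg-right u | vert-right u | sym (ℕP.+-suc l₁ u) | vert-right (suc u) = valid W₂ u u<

    walk : Walk G S
    walk = record { steps = l₁ + steps W₂ ; vertex = vert ; edge = edg ; valid = ok }
      where
      ok : ∀ t → t < l₁ + steps W₂ → Step t
      ok t t< with t ℕ.<? l₁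
      ... | yes lt = valid-left t lt
      ... | no ¬lt = subst Step (ℕP.m+[n∸m]≡n l₁≤t)
                       (valid-right (t ∸ l₁) (ℕP.+-cancelˡ-< l₁ _ _ (subst (_< l₁ + steps W₂) (sym (ℕP.m+[n∸m]≡n l₁≤t)) t<)))
        where
        l₁≤t : l₁ ≤ t
        l₁≤t = ℕP.≮⇒≥ ¬lt

  concat : (W₁ W₂ : Walk G S) → last W₁ ≡ first W₂ → Walk G S
  concat W₁ W₂ meet = Concat.walk W₁ W₂ meet

  concat-first : (W₁ W₂ : Walk G S) (meet : last W₁ ≡ first W₂) → first (concat W₁ W₂ meet) ≡ first W₁
  concat-first W₁ W₂ meet = Concat.vert-left W₁ W₂ meet 0 z≤n

  concat-last : (W₁ W₂ : Walk G S) (meet : last W₁ ≡ first W₂) → last (concat W₁ W₂ meet) ≡ last W₂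
  concat-last W₁ W₂ meet = Concat.vert-right W₁ W₂ meet (steps W₂)

  concat-negCount : (W₁ W₂ : Walk G S) (meet : last W₁ ≡ first W₂) →
                    negCount (concat W₁ W₂ meet) ≡ negCount W₁ + negCount W₂
  concat-negCount W₁ W₂ meet = trans (sumTo-+ (steps W₁) (steps W₂) _)
    (cong₂ _+_ (sumTo-cong (steps W₁) (λ t t< → cong (λ e → ind (isNeg (σ G e))) (Concat.edg-left W₁ W₂ meet t t<)))
               (sumTo-cong (steps W₂) (λ u _ → cong (λ e → ind (isNeg (σ G e))) (Concat.edg-right W₁ W₂ meet u))))

  concat-AllVertices : (P : Fin (n G) → Set) (W₁ W₂ : Walk G S) (meet : last W₁ ≡ first W₂) →
                       AllVertices P W₁ → AllVertices P W₂ → AllVertices P (concat W₁ W₂ meet)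
  concat-AllVertices P W₁ W₂ meet all₁ all₂ t t≤ with t ℕ.≤? steps W₁
  ... | yes le = subst P (sym (Concat.vert-left W₁ W₂ meet t le)) (all₁ t le)
  ... | no ¬le = subst P (sym (trans (cong (Concat.vert W₁ W₂ meet) (sym (ℕP.m+[n∸m]≡n l₁≤t))) (Concat.vert-right W₁ W₂ meet (t ∸ steps W₁))))
                   (all₂ (t ∸ steps W₁) (ℕP.+-cancelˡ-≤ (steps W₁) _ _ (subst (_≤ steps W₁ + steps W₂) (sym (ℕP.m+[n∸m]≡n l₁≤t)) t≤)))
    where
    l₁≤t : steps W₁ ≤ t
    l₁≤t = ℕP.<⇒≤ (ℕP.≰⇒> ¬le)

  prefix-AllVertices : (P : Fin (n G) → Set) (W : Walk G S) (k : ℕ) (k≤ : k ≤ steps W) → AllVertices P W → AllVertices P (prefix W k k≤)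
  prefix-AllVertices P W k k≤ all t t≤ = all t (ℕP.≤-trans t≤ k≤)

  drop-AllVertices : (P : Fin (n G) → Set) (k : ℕ) (W : Walk G S) → k ≤ steps W → AllVertices P W → AllVertices P (drop k W)
  drop-AllVertices P k W k≤ all t t≤ = all (k + t) (subst (k + t ≤_) (ℕP.m+[n∸m]≡n k≤) (ℕP.+-monoʳ-≤ k t≤))

record Repeat {V : Set} (bound : ℕ) (f : ℕ → V) : Set where
  field
    at gap : ℕ
    gap≥1 : 1 ≤ gap
    within : at + gap ≤ bound
    same : f at ≡ f (at + gap)

findRepeat : {k : ℕ} (bound : ℕ) (f : ℕ → Fin k) → Repeat bound f ⊎ Injective≤ bound f
findRepeat bound f with ℕP.anyUpTo? repeatAt? (suc bound)
  where
  repeatAt? : ∀ i → Dec (∃ λ d → d < suc bound × 1 ≤ d × i + d ≤ bound × f i ≡ f (i + d))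
  repeatAt? i = ℕP.anyUpTo? (λ d → (1 ℕ.≤? d) ×-dec (i + d ℕ.≤? bound) ×-dec (f i ≟ f (i + d))) (suc bound)
... | yes (i , _ , d , _ , d≥1 , within , same) = inj₁ (record { at = i ; gap = d ; gap≥1 = d≥1 ; within = within ; same = same })
... | no none = inj₂ λ i j i<j j≤ eq → let i+[j∸i]≡j = ℕP.m+[n∸m]≡n (ℕP.<⇒≤ i<j) in
        none (i , s≤s (ℕP.≤-trans (ℕP.<⇒≤ i<j) j≤) , j ∸ i , s≤s (ℕP.≤-trans (ℕP.m∸n≤m j i) j≤) , ℕP.m<n⇒0<n∸m i<j ,
              subst (_≤ bound) (sym i+[j∸i]≡j) j≤ , trans eq (cong f (sym i+[j∸i]≡j)))

module _ {G : SignedGraph} {S : Fin (m G) → Bool} where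

  module Shortcut (W : Walk G S) (r : Repeat (steps W) (vertex W)) where

    open Repeat r

    private
      at≤ : at ≤ steps W
      at≤ = ℕP.≤-trans (ℕP.m≤m+n at gap) within
      gap≤ : gap ≤ steps W ∸ at
      gap≤ = subst (_≤ steps W ∸ at) (ℕP.m+n∸m≡n at gap) (ℕP.∸-monoˡ-≤ at within)
      pre rest : Walk G S
      pre = prefix W at at≤
      rest = drop gap (drop at W)
      meet : last pre ≡ first rest
      meet = trans same (cong (λ j → vertex W (at + j)) (sym (ℕP.+-identityʳ gap)))

    loop : Walk G S
    loop = prefix (drop at W) gap gap≤

    walk : Walk G S
    walk = concat pre rest meet

    loop-closed : first loop ≡ last loop
    loop-closed = trans (drop-first at W) same

    first-eq : first walk ≡ first W
    first-eq = concat-first pre rest meet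

    last-eq : last walk ≡ last W
    last-eq = trans (concat-last pre rest meet) (trans (drop-last gap (drop at W) gap≤) (drop-last at W at≤))

    shorter : steps walk < steps W
    shorter = begin-strict
      at + (steps W ∸ at ∸ gap)     ≡⟨ cong (λ y → at + y) (ℕP.∸-+-assoc (steps W) at gap) ⟩
      at + (steps W ∸ (at + gap))   <⟨ ℕP.+-monoˡ-< (steps W ∸ (at + gap)) (ℕP.m<m+n at gap≥1) ⟩
      at + gap + (steps W ∸ (at + gap)) ≡⟨ ℕP.m+[n∸m]≡n within ⟩
      steps W                             ∎
      where open ℕP.≤-Reasoning

    negCount-eq : negCount W ≡ negCount walk + negCount loop
    negCount-eq = begin
      negCount W                                        ≡⟨ negCount-split W at at≤ ⟩
      negCount pre + negCount (drop at W) ≡⟨ cong (λ y → negCount pre + y) (negCount-split (drop at W) gap gap≤) ⟩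
      a + (negCount loop + b)                           ≡⟨ cong (λ y → a + y) (ℕP.+-comm (negCount loop) b) ⟩
      a + (b + negCount loop)                           ≡⟨ sym (ℕP.+-assoc a b (negCount loop)) ⟩
      a + b + negCount loop                             ≡⟨ cong (_+ negCount loop) (sym (concat-negCount pre rest meet)) ⟩
      negCount walk + negCount loop                     ∎
      where
      open ≡-Reasoning
      a = negCount pre
      b = negCount rest

    walk-AllVertices : (P : Fin (n G) → Set) → AllVertices P W → AllVertices P walk
    walk-AllVertices P all = concat-AllVertices P pre rest meet (prefix-AllVertices P W at at≤ all)
                               (drop-AllVertices P gap (drop at W) gap≤ (drop-AllVertices P at W at≤ all))

    loop-AllVertices : (P : Fin (n G) → Set) → AllVertices P W → AllVertices P loop
    loop-AllVertices P all = prefix-AllVertices P (drop at W) gap gap≤ (drop-AllVertices P at W at≤ all)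

  record SimpleWalk (x y : Fin (n G)) : Set where
    field
      walk     : Walk G S
      starts   : first walk ≡ x
      ends     : last walk ≡ y
      distinct : Distinct walk

  simplify : (W : Walk G S) → SimpleWalk (first W) (last W)
  simplify W = go (steps W) W refl
    where
    go : (k : ℕ) (W : Walk G S) → steps W ≡ k → SimpleWalk (first W) (last W)
    go = <-rec (λ k → ∀ W → steps W ≡ k → SimpleWalk (first W) (last W)) shorten
      where
      shorten : ∀ k → (∀ {j} → j < k → ∀ W → steps W ≡ j → SimpleWalk (first W) (last W)) →
             ∀ W → steps W ≡ k → SimpleWalk (first W) (last W)
      shorten k rec W refl with findRepeat (steps W) (vertex W)
      ... | inj₂ distinct = record { walk = W ; starts = refl ; ends = refl ; distinct = distinct }
      ... | inj₁ r with rec (Shortcut.shorter W r) (Shortcut.walk W r) refl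
      ...   | simple = record { walk = walk ; starts = trans starts (Shortcut.first-eq W r) ; ends = trans ends (Shortcut.last-eq W r) ; distinct = distinct }
        where open SimpleWalk simple

  distinct-steps< : (W : Walk G S) → Distinct W → steps W < n G
  distinct-steps< W distinct with steps W ℕ.<? n G
  ... | yes lt = lt
  ... | no ¬lt with FP.pigeonhole (s≤s (ℕP.≮⇒≥ ¬lt)) (λ i → vertex W (toℕ i))
  ...   | i , j , i<j , eq = ⊥-elim (distinct (toℕ i) (toℕ j) i<j (ℕP.≤-pred (FP.toℕ<n j)) eq)

  Reach-trans : {x y z : Fin (n G)} → Reach G S x y → Reach G S y z → Reach G S x z
  Reach-trans r here = r
  Reach-trans r (step e r′ s j) = step e (Reach-trans r r′) s j

  Reach-sym : {x y : Fin (n G)} → Reach G S x y → Reach G S y x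
  Reach-sym here = here
  Reach-sym (step e r s j) = Reach-trans (step e here s (Joins-sym {G} j)) (Reach-sym r)

  Reach-negCount : {v x : Fin (n G)} → Reach G S v x → ℕ
  Reach-negCount here = 0
  Reach-negCount (step e r _ _) = Reach-negCount r + ind (isNeg (σ G e))

  record WalkOf {v x : Fin (n G)} (r : Reach G S v x) : Set where
    field
      walk : Walk G S
      starts : first walk ≡ v
      ends   : last walk ≡ x
      negs : negCount walk ≡ Reach-negCount r

  -- the edge argument only fills the junk positions of a walk without steps
  walkOf : {v x : Fin (n G)} → Fin (m G) → (r : Reach G S v x) → WalkOf r
  walkOf {v} e₀ here = record { walk = trivialWalk v e₀ ; starts = refl ; ends = refl ; negs = refl }
  walkOf e₀ (step e r s j) = record
    { walk = concat walk E ends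
    ; starts = trans (concat-first walk E ends) starts
    ; ends = concat-last walk E ends
    ; negs = trans (concat-negCount walk E ends) (cong₂ _+_ negs (ℕP.+-identityʳ _)) }
    where
    open WalkOf (walkOf e₀ r)
    E = edgeWalk e s j

  walk-Reach : (W : Walk G S) → ∀ t → t ≤ steps W → Reach G S (first W) (vertex W t)
  walk-Reach W zero _ = here
  walk-Reach W (suc t) t< = step (edge W t) (walk-Reach W t (ℕP.<⇒≤ t<)) (proj₁ (valid W t t<)) (proj₂ (valid W t t<))

  private
    enters : Fin (m G) → Fin (n G) → (Fin (n G) → Bool) → Bool
    enters e x R = S e ∧ ((tgt G e == x ∧ R (src G e)) ∨ (src G e == x ∧ R (tgt G e)))

  reachableIn : Fin (n G) → ℕ → Fin (n G) → Bool
  reachableIn v zero x = v == x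
  reachableIn v (suc k) x = reachableIn v k x ∨ anyᵇ (λ e → enters e x (reachableIn v k))

  reachableIn-sound : (v : Fin (n G)) (k : ℕ) (x : Fin (n G)) → T (reachableIn v k x) → Reach G S v x
  reachableIn-sound v zero x h = subst (Reach G S v) (toWitness h) here
  reachableIn-sound v (suc k) x h with to T-∨ h
  ... | inj₁ earlier = reachableIn-sound v k x earlier
  ... | inj₂ new with anyᵇ-sound (λ e → enters e x (reachableIn v k)) new
  ...   | e , entry with to (T-∧ {S e}) entry
  ...     | s , side with to T-∨ side
  ...       | inj₁ into-tgt = let (tgt≡x , from-src) = to (T-∧ {tgt G e == x}) into-tgt in
                              step e (reachableIn-sound v k (src G e) from-src) s (inj₁ (refl , toWitness tgt≡x))
  ...       | inj₂ into-src = let (src≡x , from-tgt) = to (T-∧ {src G e == x}) into-src in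
                              step e (reachableIn-sound v k (tgt G e) from-tgt) s (inj₂ (toWitness src≡x , refl))

  reachableIn-mono : (v : Fin (n G)) (k j : ℕ) (x : Fin (n G)) → T (reachableIn v k x) → T (reachableIn v (j + k) x)
  reachableIn-mono v k zero x h = h
  reachableIn-mono v k (suc j) x h = from T-∨ (inj₁ (reachableIn-mono v k j x h))

  reachableIn-walk : (W : Walk G S) → ∀ t → t ≤ steps W → T (reachableIn (first W) t (vertex W t))
  reachableIn-walk W zero _ = fromWitness refl
  reachableIn-walk W (suc t) t< =
    from (T-∨ {reachableIn (first W) t (vertex W (suc t))})
      (inj₂ (anyᵇ-complete (λ e → enters e (vertex W (suc t)) (reachableIn (first W) t)) (edge W t)
                           (from (T-∧ {S (edge W t)}) (s , entry (proj₂ (valid W t t<))))))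
    where
    s = proj₁ (valid W t t<)
    before = reachableIn-walk W t (ℕP.<⇒≤ t<)
    entry : Joins G (edge W t) (vertex W t) (vertex W (suc t)) →
            T ((tgt G (edge W t) == vertex W (suc t) ∧ reachableIn (first W) t (src G (edge W t))) ∨
               (src G (edge W t) == vertex W (suc t) ∧ reachableIn (first W) t (tgt G (edge W t))))
    entry (inj₁ (src≡ , tgt≡)) = from T-∨ (inj₁ (from (T-∧ {tgt G (edge W t) == vertex W (suc t)}) (fromWitness tgt≡ , subst (λ z → T (reachableIn (first W) t z)) (sym src≡) before)))
    entry (inj₂ (src≡ , tgt≡)) = from (T-∨ {tgt G (edge W t) == vertex W (suc t) ∧ reachableIn (first W) t (src G (edge W t))}) (inj₂ (from (T-∧ {src G (edge W t) == vertex W (suc t)}) (fromWitness src≡ , subst (λ z → T (reachableIn (first W) t z)) (sym tgt≡) before)))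

  Reach-reachableIn : {v x : Fin (n G)} → Reach G S v x → T (reachableIn v (n G) x)
  Reach-reachableIn {v} here = subst (λ k → T (reachableIn v k v)) (ℕP.+-identityʳ (n G)) (reachableIn-mono v 0 (n G) v (fromWitness refl))
  Reach-reachableIn {v} {x} r@(step e _ _ _) =
    subst₂ (λ a b → T (reachableIn a (n G) b)) (trans S.starts W.starts) (trans S.ends W.ends)
      (subst (λ k → T (reachableIn (first S.walk) k (last S.walk))) (ℕP.m∸n+n≡m (ℕP.<⇒≤ (distinct-steps< S.walk S.distinct)))
        (reachableIn-mono (first S.walk) (steps S.walk) (n G ∸ steps S.walk) (last S.walk) (reachableIn-walk S.walk (steps S.walk) ℕP.≤-refl)))
    where
    module W = WalkOf (walkOf e r)
    module S = SimpleWalk (simplify W.walk)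

  Reach? : (v x : Fin (n G)) → Dec (Reach G S v x)
  Reach? v x = map′ (reachableIn-sound v (n G) x) Reach-reachableIn (T? (reachableIn v (n G) x))

-- Circuits and barbell paths

odd-+ : {a b : ℕ} → OddNat (a + b) → OddNat a ⊎ OddNat b
odd-+ {a} {b} odd with 2 ∣? a
... | no ¬even = inj₁ ¬even
... | yes even = inj₂ (λ even′ → odd (∣m∣n⇒∣m+n even even′))

Joins-both : {G : SignedGraph} {e : Fin (m G)} {x y x′ y′ : Fin (n G)} → Joins G e x y → Joins G e x′ y′ →
             (x ≡ x′ × y ≡ y′) ⊎ (x ≡ y′ × y ≡ x′)
Joins-both (inj₁ (p , q)) (inj₁ (p′ , q′)) = inj₁ (trans (sym p) p′ , trans (sym q) q′)
Joins-both (inj₁ (p , q)) (inj₂ (p′ , q′)) = inj₂ (trans (sym p) p′ , trans (sym q) q′)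
Joins-both (inj₂ (p , q)) (inj₁ (p′ , q′)) = inj₂ (trans (sym q) q′ , trans (sym p) p′)
Joins-both (inj₂ (p , q)) (inj₂ (p′ , q′)) = inj₁ (trans (sym q) q′ , trans (sym p) p′)

count-sumTo : (k : ℕ) (b : ℕ → Bool) → count k (λ i → b (toℕ i)) ≡ sumTo k (λ t → ind (b t))
count-sumTo zero b = refl
count-sumTo (suc k) b = cong (λ y → ind (b 0) + y) (count-sumTo k (λ t → b (suc t)))

injective-on-Fin : {V : Set} {k : ℕ} (f : ℕ → V) → Injective≤ k f → {i j : Fin (suc k)} → f (toℕ i) ≡ f (toℕ j) → i ≡ j
injective-on-Fin {k = k} f inj {i} {j} eq with ℕP.<-cmp (toℕ i) (toℕ j)
... | tri< lt _ _ = ⊥-elim (inj _ _ lt (ℕP.≤-pred (FP.toℕ<n j)) eq)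
... | tri≈ _ same _ = FP.toℕ-injective same
... | tri> _ _ gt = ⊥-elim (inj _ _ gt (ℕP.≤-pred (FP.toℕ<n i)) (sym eq))

record UnbalancedCircuitIn (G : SignedGraph) (P : Fin (n G) → Set) : Set where
  field
    circuit    : Circuit G
    unbalanced : Unbalanced circuit
    inside     : ∀ i → P (verts circuit i)

module _ {G : SignedGraph} {S : Fin (m G) → Bool} where

  -- A closed walk v₀ … v_k v₀ without repeated vertex among v₀ … v_k is a circuit, unless it
  -- runs back and forth along a single edge, which the odd number of negative edges excludes.
  module ClosedWalk (W : Walk G S) (k : ℕ) (steps≡ : steps W ≡ suc k) (closed : first W ≡ last W)
                    (odd : OddNat (negCount W)) (inj : Injective≤ k (vertex W)) where

    private
      joins-at : ∀ a → a ≤ k → Joins G (edge W a) (vertex W a) (vertex W (suc a))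
      joins-at a a≤ = proj₂ (valid W a (subst (a <_) (sym steps≡) (s≤s a≤)))

      wraps : vertex W (suc k) ≡ vertex W 0
      wraps = trans (cong (vertex W) (sym steps≡)) (sym closed)

      next-vertex : (i : Fin (suc k)) → vertex W (suc (toℕ i)) ≡ vertex W (toℕ (next i))
      next-vertex i with ℕP.m≤n⇒m<n∨m≡n (ℕP.≤-pred (FP.toℕ<n i))
      ... | inj₁ lt = cong (vertex W) (sym (trans (FP.toℕ-fromℕ< _) (m<n⇒m%n≡m (s≤s lt))))
      ... | inj₂ eq = trans (cong (λ j → vertex W (suc j)) eq) (trans wraps
                        (cong (vertex W) (sym (trans (FP.toℕ-fromℕ< _) (trans (cong (λ z → suc z % suc k) eq) (n%n≡0 (suc k)))))))

      back-and-forth : edge W 0 ≡ edge W 1 → k ≡ 1 → ⊥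
      back-and-forth same refl = odd (subst EvenNat (sym twice) (even-double (ind (isNeg (σ G (edge W 0))))))
        where
        twice : negCount W ≡ ind (isNeg (σ G (edge W 0))) + ind (isNeg (σ G (edge W 0)))
        twice rewrite steps≡ | same = cong (λ y → ind (isNeg (σ G (edge W 1))) + y) (ℕP.+-identityʳ _)

      edge-distinct : ∀ a b → a < b → b ≤ k → edge W a ≢ edge W b
      edge-distinct a b a<b b≤ same with Joins-both {G} (subst (λ e → Joins G e (vertex W a) (vertex W (suc a))) same (joins-at a (ℕP.≤-trans (ℕP.<⇒≤ a<b) b≤))) (joins-at b b≤)
      ... | inj₁ (va≡vb , _) = inj a b a<b b≤ va≡vb
      ... | inj₂ (va≡vb+1 , va+1≡vb) with ℕP.m≤n⇒m<n∨m≡n b≤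
      ...   | inj₁ b<k = inj a (suc b) (ℕP.<-trans a<b (ℕP.n<1+n b)) b<k va≡vb+1
      ...   | inj₂ refl with a
      ...     | suc a′ = inj 0 (suc a′) (s≤s z≤n) (ℕP.<⇒≤ a<b) (sym (trans va≡vb+1 wraps))
      ...     | zero with ℕP.<-cmp 1 b
      ...       | tri< 1<b _ _ = inj 1 b 1<b ℕP.≤-refl va+1≡vb
      ...       | tri≈ _ refl _ = back-and-forth same refl
      ...       | tri> _ _ (s≤s b≤0) = ℕP.<-irrefl refl (ℕP.<-≤-trans a<b b≤0)

    circuit : Circuit G
    circuit = record
      { len = k ; verts = λ i → vertex W (toℕ i) ; edges = λ i → edge W (toℕ i)
      ; verts-inj = injective-on-Fin (vertex W) inj
      ; edges-inj = injective-on-Fin (edge W) edge-distinct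
      ; joins = λ i → subst (Joins G (edge W (toℕ i)) (vertex W (toℕ i))) (next-vertex i) (joins-at (toℕ i) (ℕP.≤-pred (FP.toℕ<n i))) }

    unbalanced : Unbalanced circuit
    unbalanced even = odd (subst EvenNat
      (trans (count-sumTo (suc k) (λ t → isNeg (σ G (edge W t)))) (cong (λ j → sumTo j (λ t → ind (isNeg (σ G (edge W t))))) (sym steps≡))) even)

  closedWalk-circuit : (P : Fin (n G) → Set) (W : Walk G S) → 1 ≤ steps W → first W ≡ last W →
                       OddNat (negCount W) → AllVertices P W → UnbalancedCircuitIn G P
  closedWalk-circuit P W = <-rec Goal split (steps W) W refl
    where
    Goal : ℕ → Set
    Goal l = ∀ W → steps W ≡ l → 1 ≤ steps W → first W ≡ last W → OddNat (negCount W) → AllVertices P W → UnbalancedCircuitIn G P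
    split : ∀ l → (∀ {l′} → l′ < l → Goal l′) → Goal l
    split l rec W refl nonempty closed odd all with findRepeat (steps W ∸ 1) (vertex W)
    ... | inj₂ inj = record { circuit = circuit ; unbalanced = unbalanced
                            ; inside = λ i → all (toℕ i) (ℕP.≤-trans (ℕP.<⇒≤ (FP.toℕ<n i)) (ℕP.≤-reflexive (sym steps≡))) }
      where
      steps≡ : steps W ≡ suc (steps W ∸ 1)
      steps≡ = sym (ℕP.m+[n∸m]≡n nonempty)
      open ClosedWalk W (steps W ∸ 1) steps≡ closed odd inj
    ... | inj₁ r = recurse
      where
      open Repeat r using (at; gap; gap≥1)
      before-end : at + gap < steps W
      before-end = ℕP.<-≤-trans (s≤s (Repeat.within r)) (ℕP.≤-reflexive (ℕP.m+[n∸m]≡n nonempty))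
      r′ : Repeat (steps W) (vertex W)
      r′ = record { Repeat r ; within = ℕP.≤-trans (Repeat.within r) (ℕP.m∸n≤m (steps W) 1) }
      recurse : UnbalancedCircuitIn G P
      recurse with odd-+ (subst OddNat (Shortcut.negCount-eq W r′) odd)
      ... | inj₁ oddWalk = rec (Shortcut.shorter W r′) (Shortcut.walk W r′) refl nonempty′
                               (trans (Shortcut.first-eq W r′) (trans closed (sym (Shortcut.last-eq W r′)))) oddWalk
                               (Shortcut.walk-AllVertices W r′ P all)
        where
        nonempty′ : 1 ≤ at + (steps W ∸ at ∸ gap)
        nonempty′ = ℕP.≤-trans (ℕP.m<n⇒0<n∸m before-end)
                      (ℕP.≤-trans (ℕP.≤-reflexive (sym (ℕP.∸-+-assoc (steps W) at gap))) (ℕP.m≤n+m _ at))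
      ... | inj₂ oddLoop = rec (ℕP.≤-<-trans (ℕP.m≤n+m gap at) before-end) (Shortcut.loop W r′) refl gap≥1 (Shortcut.loop-closed W r′) oddLoop
                               (Shortcut.loop-AllVertices W r′ P all)

  OnCircuit? : (C : Circuit G) (x : Fin (n G)) → Dec (OnCircuit C x)
  OnCircuit? C x = FP.any? (λ i → verts C i Data.Fin.≟ x)

  module _ (C₁ C₂ : Circuit G) (disjoint : ∀ i j → verts C₁ i ≢ verts C₂ j) where

    record BarbellPath : Set where
      field
        path      : Path G
        start-on  : OnCircuit C₁ (startP path)
        end-on    : OnCircuit C₂ (endP path)
        inner-off : ∀ j → (OnCircuit C₁ (pverts path j) ⊎ OnCircuit C₂ (pverts path j)) →
                    (j ≡ zero) ⊎ (j ≡ fromℕ (suc (plen path)))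

    private
      InnerOn : Circuit G → Walk G S → ℕ → Set
      InnerOn C W t = 1 ≤ t × OnCircuit C (vertex W t)

      innerOn? : (C : Circuit G) (W : Walk G S) → ∀ t → Dec (InnerOn C W t)
      innerOn? C W t = (1 ℕ.≤? t) ×-dec OnCircuit? C (vertex W t)

      pathOf : (W : Walk G S) (k : ℕ) → steps W ≡ suc k → Distinct W → Path G
      pathOf W k steps≡ distinct = record
        { plen = k ; pverts = λ i → vertex W (toℕ i) ; pedges = λ i → edge W (toℕ i)
        ; pverts-inj = injective-on-Fin (vertex W) (λ i j i<j j≤ → distinct i j i<j (subst (j ≤_) (sym steps≡) j≤))
        ; pjoins = λ i → subst (λ z → Joins G (edge W (toℕ i)) (vertex W z) (vertex W (suc (toℕ i)))) (sym (FP.toℕ-inject₁ i))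
                             (proj₂ (valid W (toℕ i) (subst (toℕ i <_) (sym steps≡) (FP.toℕ<n i)))) }

    barbellPath : (W : Walk G S) → OnCircuit C₁ (first W) → OnCircuit C₂ (last W) → BarbellPath
    barbellPath W = <-rec Goal shorten (steps W) W refl
      where
      Goal : ℕ → Set
      Goal l = ∀ W → steps W ≡ l → OnCircuit C₁ (first W) → OnCircuit C₂ (last W) → BarbellPath
      shorten : ∀ l → (∀ {l′} → l′ < l → Goal l′) → Goal l
      shorten l rec W refl on₁ on₂ with ℕP.anyUpTo? (innerOn? C₁ W) (steps W)
      ... | yes (t , t< , t≥1 , on₁′) =
        rec (ℕP.∸-monoʳ-< t≥1 (ℕP.<⇒≤ t<)) (drop t W) refl (subst (OnCircuit C₁) (sym (drop-first t W)) on₁′)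
            (subst (OnCircuit C₂) (sym (drop-last t W (ℕP.<⇒≤ t<))) on₂)
      ... | no noC₁ with ℕP.anyUpTo? (innerOn? C₂ W) (steps W)
      ...   | yes (t , t< , _ , on₂′) = rec t< (prefix W t (ℕP.<⇒≤ t<)) refl on₁ on₂′
      ...   | no noC₂ with findRepeat (steps W) (vertex W)
      ...     | inj₁ r = rec (Shortcut.shorter W r) (Shortcut.walk W r) refl
                             (subst (OnCircuit C₁) (sym (Shortcut.first-eq W r)) on₁) (subst (OnCircuit C₂) (sym (Shortcut.last-eq W r)) on₂)
      ...     | inj₂ distinct = finish (steps W) refl
        where
        finish : (l : ℕ) → steps W ≡ l → BarbellPath
        finish zero steps≡ = ⊥-elim (disjoint (proj₁ on₁) (proj₁ on₂) (trans (proj₂ on₁) (trans (cong (vertex W) (sym steps≡)) (sym (proj₂ on₂)))))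
        finish (suc k) steps≡ = record
          { path = P
          ; start-on = on₁
          ; end-on = subst (OnCircuit C₂) (sym (cong (vertex W) (trans (FP.toℕ-fromℕ (suc k)) (sym steps≡)))) on₂
          ; inner-off = inner }
          where
          P = pathOf W k steps≡ distinct
          inner : ∀ j → (OnCircuit C₁ (pverts P j) ⊎ OnCircuit C₂ (pverts P j)) → (j ≡ zero) ⊎ (j ≡ fromℕ (suc k))
          inner j on with toℕ j in toℕj
          ... | zero = inj₁ (FP.toℕ-injective toℕj)
          ... | suc t with ℕP.m≤n⇒m<n∨m≡n (ℕP.≤-pred (subst (_< suc (suc k)) toℕj (FP.toℕ<n j)))
          ...   | inj₂ t≡k = inj₂ (FP.toℕ-injective (trans toℕj (trans t≡k (sym (FP.toℕ-fromℕ (suc k))))))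
          ...   | inj₁ t<k with on
          ...     | inj₁ on₁′ = ⊥-elim (noC₁ (suc t , subst (suc t <_) (sym steps≡) t<k , s≤s z≤n , on₁′))
          ...     | inj₂ on₂′ = ⊥-elim (noC₂ (suc t , subst (suc t <_) (sym steps≡) t<k , s≤s z≤n , on₂′))

-- Closed sets of the odd-flow subgraph

least : {k : ℕ} (P : Fin k → Set) → (∀ i → Dec (P i)) → (i : Fin k) → P i →
        Σ (Fin k) λ y → P y × (∀ z → P z → toℕ y ≤ toℕ z)
least {suc k} P P? i p with P? zero
... | yes p₀ = zero , p₀ , λ _ _ → z≤n
... | no ¬p₀ with i
...   | zero = ⊥-elim (¬p₀ p)
...   | suc i′ with least (λ j → P (suc j)) (λ j → P? (suc j)) i′ p
...     | y , py , minimal = suc y , py , λ { zero pz → ⊥-elim (¬p₀ pz) ; (suc z) pz → s≤s (minimal z pz) }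

Reach-mono : {G : SignedGraph} {S S′ : Fin (m G) → Bool} → (∀ e → T (S e) → T (S′ e)) →
             {x y : Fin (n G)} → Reach G S x y → Reach G S′ x y
Reach-mono S⊆S′ here = here
Reach-mono S⊆S′ (step e r s j) = step e (Reach-mono S⊆S′ r) (S⊆S′ e s) j

ClosedUnder : (G : SignedGraph) → (Fin (m G) → Bool) → (Fin (n G) → Bool) → Set
ClosedUnder G S U = ∀ e → T (S e) → U (src G e) ≡ U (tgt G e)

ClosedUnder-Reach : {G : SignedGraph} {S : Fin (m G) → Bool} (U : Fin (n G) → Bool) → ClosedUnder G S U →
                    {x y : Fin (n G)} → Reach G S x y → U x ≡ U y
ClosedUnder-Reach U closed here = refl
ClosedUnder-Reach U closed (step e r s (inj₁ (src≡ , tgt≡))) =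
  trans (ClosedUnder-Reach U closed r) (trans (cong U (sym src≡)) (trans (closed e s) (cong U tgt≡)))
ClosedUnder-Reach U closed (step e r s (inj₂ (src≡ , tgt≡))) =
  trans (ClosedUnder-Reach U closed r) (trans (cong U (sym tgt≡)) (trans (sym (closed e s)) (cong U src≡)))

-- Components of S are represented by their least vertex; the potential of x is the parity of the
-- negative edges on a fixed path from the representative to x.
module Components (G : SignedGraph) (S : Fin (m G) → Bool) where

  private
    leastReaching : (x : Fin (n G)) → Σ (Fin (n G)) λ y → Reach G S y x × (∀ z → Reach G S z x → toℕ y ≤ toℕ z)
    leastReaching x = least (λ y → Reach G S y x) (λ y → Reach? y x) x here

  root : Fin (n G) → Fin (n G)
  root x = proj₁ (leastReaching x)

  root-Reach : (x : Fin (n G)) → Reach G S (root x) x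
  root-Reach x = proj₁ (proj₂ (leastReaching x))

  Reach⇒same-root : {x y : Fin (n G)} → Reach G S x y → root x ≡ root y
  Reach⇒same-root {x} {y} r = FP.toℕ-injective (ℕP.≤-antisym
    (proj₂ (proj₂ (leastReaching x)) (root y) (Reach-trans (root-Reach y) (Reach-sym r)))
    (proj₂ (proj₂ (leastReaching y)) (root x) (Reach-trans (root-Reach x) r)))

  same-root⇒Reach : {x y : Fin (n G)} → root x ≡ root y → Reach G S x y
  same-root⇒Reach {x} {y} eq = Reach-trans (Reach-sym (root-Reach x)) (subst (λ z → Reach G S z y) (sym eq) (root-Reach y))

  root-idem : (x : Fin (n G)) → root (root x) ≡ root x
  root-idem x = Reach⇒same-root (root-Reach x)

  root-edge : (e : Fin (m G)) → T (S e) → root (src G e) ≡ root (tgt G e)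
  root-edge e s = Reach⇒same-root (step e here s (inj₁ (refl , refl)))

  walk-root : (W : Walk G S) → AllVertices (λ v → root v ≡ root (first W)) W
  walk-root W t t≤ = sym (Reach⇒same-root (walk-Reach W t t≤))

  potential : Fin (n G) → Bool
  potential x = oddᵇ (Reach-negCount (root-Reach x))

  Frustrated : Fin (m G) → Bool
  Frustrated e = S e ∧ ((potential (src G e) xor potential (tgt G e)) xor isNeg (σ G e))

  unbalancedRoot : Fin (n G) → Bool
  unbalancedRoot r = anyᵇ (λ e → Frustrated e ∧ (root (src G e) == r))

  InUnbalanced : Fin (n G) → Bool
  InUnbalanced x = unbalancedRoot (root x)

  frustrated-odd : (e : Fin (m G)) → T (Frustrated e) →
                   OddNat (Reach-negCount (root-Reach (src G e)) + (ind (isNeg (σ G e)) + 0) + Reach-negCount (root-Reach (tgt G e)))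
  frustrated-odd e frustrated even = subst T (trans (sym parity) (even⇒¬oddᵇ _ even)) tt
    where
    a = Reach-negCount (root-Reach (src G e))
    b = Reach-negCount (root-Reach (tgt G e))
    swap : ∀ x y z → (x xor y) xor z ≡ (x xor z) xor y
    swap x y z = trans (xor-assoc x y z) (trans (cong (x xor_) (xor-comm y z)) (sym (xor-assoc x z y)))
    parity : oddᵇ (a + (ind (isNeg (σ G e)) + 0) + b) ≡ true
    parity = begin
      oddᵇ (a + (ind (isNeg (σ G e)) + 0) + b)                  ≡⟨ oddᵇ-+ (a + (ind (isNeg (σ G e)) + 0)) b ⟩
      oddᵇ (a + (ind (isNeg (σ G e)) + 0)) xor potential (tgt G e)
        ≡⟨ cong (_xor potential (tgt G e)) (trans (oddᵇ-+ a _) (cong (potential (src G e) xor_)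
             (trans (cong oddᵇ (ℕP.+-identityʳ (ind (isNeg (σ G e))))) (oddᵇ-ind (isNeg (σ G e)))))) ⟩
      (potential (src G e) xor isNeg (σ G e)) xor potential (tgt G e)
        ≡⟨ swap (potential (src G e)) (isNeg (σ G e)) (potential (tgt G e)) ⟩
      (potential (src G e) xor potential (tgt G e)) xor isNeg (σ G e)
        ≡⟨ to T-≡ (proj₂ (to (T-∧ {S e}) frustrated)) ⟩
      true ∎
      where open ≡-Reasoning

  frustrated-circuit : (e : Fin (m G)) → T (Frustrated e) → UnbalancedCircuitIn G (λ v → root v ≡ root (src G e))
  frustrated-circuit e frustrated =
    closedWalk-circuit P cycle nonempty closed odd inside
    where
    s = proj₁ (to (T-∧ {S e}) frustrated)
    module W₁ = WalkOf (walkOf e (root-Reach (src G e)))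
    module W₂ = WalkOf (walkOf e (root-Reach (tgt G e)))
    E = edgeWalk e s (inj₁ (refl , refl))
    W₁E = concat W₁.walk E W₁.ends
    meet : last W₁E ≡ first (reverse W₂.walk)
    meet = trans (concat-last W₁.walk E W₁.ends) (sym W₂.ends)
    cycle = concat W₁E (reverse W₂.walk) meet
    P : Fin (n G) → Set
    P v = root v ≡ root (src G e)
    nonempty : 1 ≤ steps cycle
    nonempty = ℕP.≤-trans (ℕP.m≤n+m 1 (steps W₁.walk)) (ℕP.m≤m+n (steps W₁.walk + 1) (steps W₂.walk))
    closed : first cycle ≡ last cycle
    closed = begin
      first cycle              ≡⟨ trans (concat-first W₁E (reverse W₂.walk) meet) (concat-first W₁.walk E W₁.ends) ⟩
      first W₁.walk            ≡⟨ trans W₁.starts (root-edge e s) ⟩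
      root (tgt G e)           ≡⟨ sym W₂.starts ⟩
      first W₂.walk            ≡⟨ sym (trans (concat-last W₁E (reverse W₂.walk) meet) (reverse-last W₂.walk)) ⟩
      last cycle               ∎
      where open ≡-Reasoning
    a = Reach-negCount (root-Reach (src G e))
    b = Reach-negCount (root-Reach (tgt G e))
    negs : negCount cycle ≡ a + (ind (isNeg (σ G e)) + 0) + b
    negs = trans (concat-negCount W₁E (reverse W₂.walk) meet)
             (cong₂ _+_ (trans (concat-negCount W₁.walk E W₁.ends) (cong (_+ (ind (isNeg (σ G e)) + 0)) W₁.negs))
                        (trans (reverse-negCount W₂.walk) W₂.negs))
    odd : OddNat (negCount cycle)
    odd = subst OddNat (sym negs) (frustrated-odd e frustrated)
    inside : AllVertices P cycle
    inside = concat-AllVertices P W₁E (reverse W₂.walk) meet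
               (concat-AllVertices P W₁.walk E W₁.ends
                  (λ t t≤ → trans (walk-root W₁.walk t t≤) (trans (cong root W₁.starts) (root-idem (src G e))))
                  (λ t t≤ → trans (walk-root E t t≤) refl))
               (reverse-AllVertices P W₂.walk
                  (λ t t≤ → trans (walk-root W₂.walk t t≤) (trans (cong root W₂.starts) (trans (root-idem (tgt G e)) (sym (root-edge e s))))))

negInside : (G : SignedGraph) → (Fin (m G) → Bool) → (Fin (n G) → Bool) → ℕ
negInside G S U = count (m G) (λ e → S e ∧ U (src G e) ∧ U (tgt G e) ∧ isNeg (σ G e))

EvenOnClosedSets : (G : SignedGraph) → (Fin (m G) → Bool) → Set
EvenOnClosedSets G S = ∀ U → ClosedUnder G S U → EvenNat (negInside G S U)

count-cong : (k : ℕ) {b c : Fin k → Bool} → (∀ i → b i ≡ c i) → count k b ≡ count k c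
count-cong k {b} {c} eq = trans (count≡sum k b) (trans (ℕSum.sum-cong-≋ (λ i → cong ind (eq i))) (sym (count≡sum k c)))

OddEdges : (G : SignedGraph) → (Fin (m G) → ℤ) → Fin (m G) → Bool
OddEdges G f e = oddℤ (f e)

length-filter-tabulate : {A : Set} {k : ℕ} (P : A → Bool) (f : Fin k → A) →
                         List.length (List.filter (λ x → T? (P x)) (List.tabulate f)) ≡ count k (λ i → P (f i))
length-filter-tabulate {k = zero} P f = refl
length-filter-tabulate {k = suc k} P f with P (f zero)
... | true = cong suc (length-filter-tabulate P (λ i → f (suc i)))
... | false = length-filter-tabulate P (λ i → f (suc i))

evenCard-from-count : {k : ℕ} (P : Fin k → Set) (b : Fin k → Bool) → (∀ e → T (b e) → P e) → (∀ e → P e → T (b e)) →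
                      EvenNat (count k b) → EvenCard P
evenCard-from-count {k} P b sound complete even =
  elements , filter⁺ (λ e → T? (b e)) (allFin⁺ k) ,
  (λ e → mk⇔ (λ e∈ → sound e (proj₂ (∈-filter⁻ (λ x → T? (b x)) {xs = List.allFin k} e∈))) (λ p → ∈-filter⁺ (λ x → T? (b x)) (∈-allFin e) (complete e p))) ,
  subst EvenNat (sym (length-filter-tabulate b (λ i → i))) even
  where
  elements = List.filter (λ e → T? (b e)) (List.allFin k)

module OddEdgesEvenOnClosedSets (G : SignedGraph) (τ : Orientation G) (f : Fin (m G) → ℤ)
         (or : IsOrientationOn G all τ) (flow : ∀ v → boundary G all τ f v ≡ + 0) (noBarbell : ¬ LongBarbell G) where

  Q : Fin (m G) → Bool
  Q = OddEdges G f

  open Components G Q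

  unbalanced-witness : (z : Fin (n G)) → T (InUnbalanced z) → Σ (Fin (m G)) λ e → T (Frustrated e) × root (src G e) ≡ root z
  unbalanced-witness z unb with anyᵇ-sound _ unb
  ... | e , p = e , proj₁ (to (T-∧ {Frustrated e}) p) , toWitness (proj₂ (to (T-∧ {Frustrated e}) p))

  unbalanced-circuit : (z : Fin (n G)) → T (InUnbalanced z) → UnbalancedCircuitIn G (λ v → root v ≡ root z)
  unbalanced-circuit z unb with unbalanced-witness z unb
  ... | e , frustrated , root≡ with frustrated-circuit e frustrated
  ...   | record { circuit = C ; unbalanced = u ; inside = inside } =
          record { circuit = C ; unbalanced = u ; inside = λ i → trans (inside i) root≡ }

  private
    barbell : {x y : Fin (n G)} → root x ≢ root y → Reach G all x y →
              UnbalancedCircuitIn G (λ v → root v ≡ root x) → UnbalancedCircuitIn G (λ v → root v ≡ root y) → LongBarbell G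
    barbell {x} {y} apart x⇝y c₁ c₂ = record
      { C₁ = C₁ ; C₂ = C₂ ; unb₁ = UnbalancedCircuitIn.unbalanced c₁ ; unb₂ = UnbalancedCircuitIn.unbalanced c₂ ; disjoint = disjoint
      ; P = BarbellPath.path B ; start-on = BarbellPath.start-on B ; end-on = BarbellPath.end-on B ; inner-off = BarbellPath.inner-off B }
      where
      C₁ = UnbalancedCircuitIn.circuit c₁
      C₂ = UnbalancedCircuitIn.circuit c₂
      disjoint : ∀ i j → verts C₁ i ≢ verts C₂ j
      disjoint i j eq = apart (trans (sym (UnbalancedCircuitIn.inside c₁ i)) (trans (cong root eq) (UnbalancedCircuitIn.inside c₂ j)))
      Q⊆all : ∀ e → T (Q e) → T (all e)
      Q⊆all _ _ = tt
      joined : Reach G all (verts C₁ zero) (verts C₂ zero)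
      joined = Reach-trans (Reach-mono Q⊆all (same-root⇒Reach (UnbalancedCircuitIn.inside c₁ zero)))
                 (Reach-trans x⇝y (Reach-mono Q⊆all (same-root⇒Reach (sym (UnbalancedCircuitIn.inside c₂ zero)))))
      W : WalkOf joined
      W = walkOf (edges C₁ zero) joined
      B : BarbellPath C₁ C₂ disjoint
      B = barbellPath C₁ C₂ disjoint (WalkOf.walk W) (zero , sym (WalkOf.starts W)) (zero , sym (WalkOf.ends W))

  unbalanced-components-apart : (x y : Fin (n G)) → T (InUnbalanced x) → T (InUnbalanced y) → root x ≢ root y →
                                Reach G all x y → ⊥
  unbalanced-components-apart x y unb-x unb-y apart x⇝y =
    noBarbell (barbell apart x⇝y (unbalanced-circuit x unb-x) (unbalanced-circuit y unb-y))

  switching : Fin (n G) → Sign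
  switching x = if InUnbalanced x then plus else signOf (potential x)

  switched-negative⇒unbalanced : (e : Fin (m G)) → T (Q e) →
                                 T (isNeg (switched (switching (src G e)) (switching (tgt G e)) (σ G e))) → T (InUnbalanced (src G e))
  switched-negative⇒unbalanced e q = by-cases (InUnbalanced (src G e)) refl (InUnbalanced (tgt G e)) refl
    where
    same : InUnbalanced (src G e) ≡ InUnbalanced (tgt G e)
    same = cong unbalancedRoot (root-edge e q)
    frustrated : T (isNeg (switched (signOf (potential (src G e))) (signOf (potential (tgt G e))) (σ G e))) → T (Frustrated e)
    frustrated neg = from (T-∧ {Q e}) (q , subst T (isNeg-switched-signOf (potential (src G e)) (potential (tgt G e)) (σ G e)) neg)
    by-cases : (a : Bool) → InUnbalanced (src G e) ≡ a → (b : Bool) → InUnbalanced (tgt G e) ≡ b →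
               T (isNeg (switched (if a then plus else signOf (potential (src G e))) (if b then plus else signOf (potential (tgt G e))) (σ G e))) →
               T a
    by-cases true _ _ _ _ = tt
    by-cases false u₁ true u₂ _ = subst T (trans (sym u₂) (trans (sym same) u₁)) tt
    by-cases false u₁ false u₂ neg =
      subst T u₁ (anyᵇ-complete (λ e′ → Frustrated e′ ∧ (root (src G e′) == root (src G e))) e
                                (from (T-∧ {Frustrated e}) (frustrated neg , fromWitness refl)))

  -- After switching, the odd negative edges lie in unbalanced components of Q. As no long barbell
  -- exists, the unbalanced components meeting U are the only ones reachable from U in G, so on
  -- those edges U agrees with the set Z of vertices they reach, which is closed in all of G.
  evenOnClosedSets : EvenOnClosedSets G Q
  evenOnClosedSets U closed = oddNegCount-parity-switch G τ f or flow U noCross switching (λ _ → plus) evenSwitched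
    where
    noCross : NoOddCrossing G τ f U
    noCross e crossing with oddℤ (f e) in odd
    ... | false = refl
    ... | true = ⊥-elim (subst T (trans (cong (_xor U (tgt G e)) (closed e (subst T (sym odd) tt))) (xor-same (U (tgt G e)))) crossing)
    Z : Fin (n G) → Bool
    Z x = anyᵇ (λ y → InUnbalanced y ∧ U y ∧ ⌊ Reach? {G} {all} y x ⌋)
    Z-closed : ∀ e → Z (src G e) ≡ Z (tgt G e)
    Z-closed e = T-extensional (extend (src G e) (tgt G e) (inj₁ (refl , refl))) (extend (tgt G e) (src G e) (inj₂ (refl , refl)))
      where
      extend : ∀ a b → Joins G e a b → T (Z a) → T (Z b)
      extend a b j za with anyᵇ-sound _ za
      ... | y , p with to (T-∧ {InUnbalanced y}) p
      ...   | unb , p′ with to (T-∧ {U y}) p′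
      ...     | uy , reach = anyᵇ-complete _ y (from T-∧ (unb , from T-∧ (uy , fromWitness (step e (toWitness reach) tt j))))
    U≡Z : ∀ x → T (InUnbalanced x) → U x ≡ Z x
    U≡Z x unb-x = T-extensional
      (λ ux → anyᵇ-complete _ x (from T-∧ (unb-x , from T-∧ (ux , fromWitness here))))
      (λ zx → let (y , p) = anyᵇ-sound _ zx
                  (unb-y , p′) = to (T-∧ {InUnbalanced y}) p
                  (uy , reach) = to (T-∧ {U y}) p′
              in same-component y unb-y uy (toWitness reach))
      where
      same-component : ∀ y → T (InUnbalanced y) → T (U y) → Reach G all y x → T (U x)
      same-component y unb-y uy y⇝x with root y ≟ root x
      ... | yes same = subst T (ClosedUnder-Reach U closed (same-root⇒Reach same)) uy
      ... | no apart = ⊥-elim (unbalanced-components-apart y x unb-y unb-x apart y⇝x)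
    agree : ∀ e → OddNegIn G τ f U switching e ≡ OddNegIn G τ f Z switching e
    agree e with oddℤ (f e) in odd | isNeg (switched (switching (src G e)) (switching (tgt G e)) (σ G e)) in neg
    ... | false | _ = refl
    ... | true | false = trans (∧-false (U (src G e)) (U (tgt G e))) (sym (∧-false (Z (src G e)) (Z (tgt G e))))
      where
      ∧-false : ∀ a b → (a ∧ b ∧ false) ≡ false
      ∧-false a b = trans (cong (a ∧_) (∧-zeroʳ b)) (∧-zeroʳ a)
    ... | true | true = cong₂ (λ a b → a ∧ b ∧ true) src-agrees (trans (sym (closed e q)) (trans src-agrees (Z-closed e)))
      where
      q : T (Q e)
      q = subst T (sym odd) tt
      src-agrees : U (src G e) ≡ Z (src G e)
      src-agrees = U≡Z (src G e) (switched-negative⇒unbalanced e q (subst T (sym neg) tt))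
    evenSwitched : EvenNat (oddNegCount G τ f U switching)
    evenSwitched = subst EvenNat (sym (count-cong (m G) agree)) (oddNegCount-even-if-closed G τ f or flow Z switching Z-closed)

  negativeEdgesOfComponent-even : ∀ v → EvenCard (NegEdgeOfComponent G Q v)
  negativeEdgesOfComponent-even v =
    evenCard-from-count (NegEdgeOfComponent G Q v) (λ e → Q e ∧ U (src G e) ∧ U (tgt G e) ∧ isNeg (σ G e)) sound complete
      (evenOnClosedSets U U-closed)
    where
    U : Fin (n G) → Bool
    U x = ⌊ Reach? {G} {Q} v x ⌋
    U-closed : ClosedUnder G Q U
    U-closed e q = T-extensional (λ h → fromWitness (step e (toWitness h) q (inj₁ (refl , refl))))
                                 (λ h → fromWitness (step e (toWitness h) q (inj₂ (refl , refl))))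
    isNeg⇒minus : ∀ s → T (isNeg s) → s ≡ minus
    isNeg⇒minus minus _ = refl
    sound : ∀ e → T (Q e ∧ U (src G e) ∧ U (tgt G e) ∧ isNeg (σ G e)) → NegEdgeOfComponent G Q v e
    sound e h with to (T-∧ {Q e}) h
    ... | q , h′ with to (T-∧ {U (src G e)}) h′
    ...   | in-src , h″ = q , toWitness in-src , isNeg⇒minus (σ G e) (proj₂ (to (T-∧ {U (tgt G e)}) h″))
    complete : ∀ e → NegEdgeOfComponent G Q v e → T (Q e ∧ U (src G e) ∧ U (tgt G e) ∧ isNeg (σ G e))
    complete e (q , v⇝src , neg) = from (T-∧ {Q e}) (q , from (T-∧ {U (src G e)}) (fromWitness v⇝src ,
      from (T-∧ {U (tgt G e)}) (fromWitness (step e v⇝src q (inj₁ (refl , refl))) , subst (λ s → T (isNeg s)) (sym neg) tt)))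

-- Nowhere-zero 2-flows by splitting off

degree : (G : SignedGraph) → (Fin (m G) → Bool) → Fin (n G) → ℕ
degree G S v = ℕSum.sum (λ e → if S e then ind (src G e == v) + ind (tgt G e == v) else 0)

EvenDegrees : (G : SignedGraph) → (Fin (m G) → Bool) → Set
EvenDegrees G S = ∀ v → EvenNat (degree G S v)

even-2* : (a : ℕ) → EvenNat (2 * a)
even-2* a = divides a (ℕP.*-comm 2 a)

ind-+ : (x y : Bool) → ind x + ind y ≡ ind (x xor y) + 2 * ind (x ∧ y)
ind-+ true true = refl
ind-+ true false = refl
ind-+ false true = refl
ind-+ false false = refl

count-none : (k : ℕ) (b : Fin k → Bool) → (∀ i → ¬ T (b i)) → count k b ≡ 0
count-none zero b none = refl
count-none (suc k) b none = trans (cong (λ x → ind x + count k (λ i → b (suc i))) (¬T⇒≡false (none zero)))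
                                  (count-none k (λ i → b (suc i)) (λ i → none (suc i)))

count-+ : (k : ℕ) (b c d : Fin k → Bool) → (∀ i → ind (b i) + ind (c i) ≡ ind (d i)) → count k b + count k c ≡ count k d
count-+ zero b c d h = refl
count-+ (suc k) b c d h =
  trans (interchange (ind (b zero)) (count k (λ i → b (suc i))) (ind (c zero)) (count k (λ i → c (suc i))))
        (cong₂ _+_ (h zero) (count-+ k (λ i → b (suc i)) (λ i → c (suc i)) (λ i → d (suc i)) (λ i → h (suc i))))
  where
  interchange : ∀ w x y z → (w + x) + (y + z) ≡ (w + y) + (x + z)
  interchange = ℕSolver.solve-∀

-- Handshake: summing degrees over B counts inner edges twice and crossing edges once.
even-crossing : (G : SignedGraph) (S : Fin (m G) → Bool) → EvenDegrees G S → (B : Fin (n G) → Bool) →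
                EvenNat (count (m G) (λ e → S e ∧ (B (src G e) xor B (tgt G e))))
even-crossing G S even B = ∣m+n∣m⇒∣n (subst EvenNat (trans total (ℕP.+-comm crossing (2 * inner))) evenSum) (even-2* inner)
  where
  open ℕSum using (sum; sum-cong-≋; ∑-comm; ∑-distrib-+; sum-pick)
  inc : Fin (n G) → Fin (m G) → ℕ
  inc v e = if S e then ind (src G e == v) + ind (tgt G e == v) else 0
  crossing inner : ℕ
  crossing = count (m G) (λ e → S e ∧ (B (src G e) xor B (tgt G e)))
  inner = count (m G) (λ e → S e ∧ B (src G e) ∧ B (tgt G e))
  evenSum : EvenNat (sum (λ v → ind (B v) * degree G S v))
  evenSum = ℕSum-even (λ v → ind (B v) * degree G S v) λ v → weighted (B v) v
    where
    weighted : ∀ b v → EvenNat (ind b * degree G S v)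
    weighted true v = subst EvenNat (sym (ℕP.+-identityʳ _)) (even v)
    weighted false v = divides 0 refl
    ℕSum-even : {k : ℕ} (g : Fin k → ℕ) → (∀ i → EvenNat (g i)) → EvenNat (sum g)
    ℕSum-even {zero} g _ = divides 0 refl
    ℕSum-even {suc k} g ev = ∣m∣n⇒∣m+n (ev zero) (ℕSum-even (λ i → g (suc i)) (λ i → ev (suc i)))
  per-edge : ∀ e → sum (λ v → ind (B v) * inc v e) ≡ ind (S e ∧ (B (src G e) xor B (tgt G e))) + 2 * ind (S e ∧ B (src G e) ∧ B (tgt G e))
  per-edge e with S e
  ... | false = trans (sum-cong-≋ (λ v → ℕP.*-zeroʳ (ind (B v)))) (ℕSum.sum-replicate-zero (n G))
  ... | true = trans (sum-cong-≋ (λ v → trans (ℕP.*-distribˡ-+ (ind (B v)) _ _) (cong₂ _+_ (pick (src G e == v) (ind (B v))) (pick (tgt G e == v) (ind (B v))))))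
                 (trans (∑-distrib-+ (λ v → if src G e == v then ind (B v) else 0) (λ v → if tgt G e == v then ind (B v) else 0))
                 (trans (cong₂ _+_ (sum-pick (src G e) (λ v → ind (B v))) (sum-pick (tgt G e) (λ v → ind (B v))))
                   (ind-+ (B (src G e)) (B (tgt G e)))))
    where
    pick : ∀ b x → x * ind b ≡ (if b then x else 0)
    pick true x = ℕP.*-identityʳ x
    pick false x = ℕP.*-zeroʳ x
  total : sum (λ v → ind (B v) * degree G S v) ≡ crossing + 2 * inner
  total = begin
    sum (λ v → ind (B v) * degree G S v)                  ≡⟨ sum-cong-≋ (λ v → ℕSemiringSum.*-distribˡ-sum (ind (B v)) (inc v)) ⟩
    sum (λ v → sum (λ e → ind (B v) * inc v e))           ≡⟨ ∑-comm (λ v e → ind (B v) * inc v e) ⟩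
    sum (λ e → sum (λ v → ind (B v) * inc v e))           ≡⟨ sum-cong-≋ per-edge ⟩
    sum (λ e → ind (S e ∧ (B (src G e) xor B (tgt G e))) + 2 * ind (S e ∧ B (src G e) ∧ B (tgt G e)))
      ≡⟨ ∑-distrib-+ (λ e → ind (S e ∧ (B (src G e) xor B (tgt G e)))) (λ e → 2 * ind (S e ∧ B (src G e) ∧ B (tgt G e))) ⟩
    sum (λ e → ind (S e ∧ (B (src G e) xor B (tgt G e)))) + sum (λ e → 2 * ind (S e ∧ B (src G e) ∧ B (tgt G e)))
      ≡⟨ cong₂ _+_ (sym (count≡sum (m G) _)) (trans (sym (ℕSemiringSum.*-distribˡ-sum 2 (λ e → ind (S e ∧ B (src G e) ∧ B (tgt G e))))) (cong (2 *_) (sym (count≡sum (m G) _)))) ⟩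
    crossing + 2 * inner ∎
    where open ≡-Reasoning

if-∧-not : {A : Set} (z : A) (b c : Bool) {x : A} → (if b then z else (if c then x else z)) ≡ (if c ∧ not b then x else z)
if-∧-not z true true = refl
if-∧-not z true false = refl
if-∧-not z false true = refl
if-∧-not z false false = refl

count-without : (k : ℕ) (S : Fin k → Bool) (L : Fin k) → T (S L) → count k S ≡ suc (count k (λ e → S e ∧ not (L == e)))
count-without k S L s = begin
  count k S                                                  ≡⟨ count≡sum k S ⟩
  ℕSum.sum (λ e → ind (S e))                                 ≡⟨ ℕSum.sum-drop L (λ e → ind (S e)) ⟩
  ℕSum.sum (λ e → if L == e then 0 else ind (S e)) + ind (S L) ≡⟨ cong₂ _+_ (ℕSum.sum-cong-≋ (λ e → if-∧-not 0 (L == e) (S e))) (cong ind (to T-≡ s)) ⟩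
  ℕSum.sum (λ e → ind (S e ∧ not (L == e))) + 1              ≡⟨ cong (_+ 1) (sym (count≡sum k _)) ⟩
  count k (λ e → S e ∧ not (L == e)) + 1                     ≡⟨ ℕP.+-comm _ 1 ⟩
  suc (count k (λ e → S e ∧ not (L == e)))                   ∎
  where open ≡-Reasoning

module RemovePositiveLoop (G : SignedGraph) (S : Fin (m G) → Bool) (L : Fin (m G)) (sL : T (S L))
                          (loop : src G L ≡ tgt G L) (positive : σ G L ≡ plus) where

  S′ : Fin (m G) → Bool
  S′ e = S e ∧ not (L == e)

  fewer : count (m G) S ≡ suc (count (m G) S′)
  fewer = count-without (m G) S L sL

  evenDegrees : EvenDegrees G S → EvenDegrees G S′
  evenDegrees even v = ∣m+n∣m⇒∣n (subst EvenNat (trans split (ℕP.+-comm (degree G S′ v) _)) (even v)) (even-double (ind (src G L == v)))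
    where
    split : degree G S v ≡ degree G S′ v + (ind (src G L == v) + ind (src G L == v))
    split = trans (ℕSum.sum-drop L _) (cong₂ _+_ (ℕSum.sum-cong-≋ λ e → if-∧-not 0 (L == e) (S e))
                                                  (trans (cong (λ b → if b then ind (src G L == v) + ind (tgt G L == v) else 0) (to T-≡ sL))
                                                         (cong (λ x → ind (src G L == v) + ind (x == v)) (sym loop))))

  evenOnClosedSets : EvenOnClosedSets G S → EvenOnClosedSets G S′
  evenOnClosedSets even U closed = subst EvenNat same (even U closedS)
    where
    closedS : ClosedUnder G S U
    closedS e s with L ≟ e
    ... | yes refl = cong U loop
    ... | no L≢e = closed e (from (T-∧ {S e}) (s , subst T (cong not (sym (==-≢ L≢e))) tt))
    inside : Fin (m G) → Bool
    inside e = S e ∧ U (src G e) ∧ U (tgt G e) ∧ isNeg (σ G e)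
    L-outside : inside L ≡ false
    L-outside rewrite positive = ∧-false (S L) (U (src G L)) (U (tgt G L))
      where
      ∧-false : ∀ a b c → (a ∧ b ∧ c ∧ false) ≡ false
      ∧-false a b c = trans (cong (λ x → a ∧ b ∧ x) (∧-zeroʳ c)) (trans (cong (a ∧_) (∧-zeroʳ b)) (∧-zeroʳ a))
    reassoc : ∀ s k {rest : Bool} → ((s ∧ rest) ∧ k) ≡ ((s ∧ k) ∧ rest)
    reassoc true true = ∧-identityʳ _
    reassoc true false = ∧-zeroʳ _
    reassoc false k = refl
    same : negInside G S U ≡ negInside G S′ U
    same = begin
      count (m G) inside                                             ≡⟨ count≡sum (m G) inside ⟩
      ℕSum.sum (λ e → ind (inside e))                                ≡⟨ ℕSum.sum-drop L (λ e → ind (inside e)) ⟩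
      ℕSum.sum (λ e → if L == e then 0 else ind (inside e)) + ind (inside L)
        ≡⟨ cong₂ _+_ (ℕSum.sum-cong-≋ (λ e → trans (if-∧-not 0 (L == e) (inside e)) (cong ind (reassoc (S e) (not (L == e))))))
                     (cong ind L-outside) ⟩
      ℕSum.sum (λ e → ind (S′ e ∧ U (src G e) ∧ U (tgt G e) ∧ isNeg (σ G e))) + 0 ≡⟨ ℕP.+-identityʳ _ ⟩
      ℕSum.sum (λ e → ind (S′ e ∧ U (src G e) ∧ U (tgt G e) ∧ isNeg (σ G e))) ≡⟨ sym (count≡sum (m G) _) ⟩
      negInside G S′ U ∎
      where open ≡-Reasoning

  module Lift (τ′ : Orientation G) (g′ : Fin (m G) → ℤ) (oriented′ : IsOrientationOn G S′ τ′)
              (nowhereZero′ : ∀ e → T (S′ e) → (g′ e ≡ + 1) ⊎ (g′ e ≡ - (+ 1))) (conserved′ : ∀ v → boundary G S′ τ′ g′ v ≡ + 0) where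
    τ : Orientation G
    τ e b = if L == e then (if b then minus else plus) else τ′ e b
    g : Fin (m G) → ℤ
    g e = if L == e then + 1 else g′ e
    in-S′ : ∀ e → T (S e) → (L == e) ≡ false → T (S′ e)
    in-S′ e s L≢e = from (T-∧ {S e}) (s , subst (λ b → T (not b)) (sym L≢e) tt)
    oriented : IsOrientationOn G S τ
    oriented e s with L == e in L≡e
    ... | true rewrite sym (toWitness (subst T (sym L≡e) tt)) | positive = refl
    ... | false = oriented′ e (in-S′ e s L≡e)
    nowhereZero : ∀ e → T (S e) → (g e ≡ + 1) ⊎ (g e ≡ - (+ 1))
    nowhereZero e s with L == e in L≡e
    ... | true = inj₁ refl
    ... | false = nowhereZero′ e (in-S′ e s L≡e)
    H H′ : Fin (n G) → Fin (m G) → ℤ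
    H v e = half G τ g v e false ℤ.+ half G τ g v e true
    H′ v e = half G τ′ g′ v e false ℤ.+ half G τ′ g′ v e true
    loop-cancels : ∀ v → H v L ≡ + 0
    loop-cancels v rewrite ==-refl L | sym loop with src G L == v
    ... | true = refl
    ... | false = refl
    agree : ∀ v e → (if L == e then + 0 else (if S e then H v e else + 0)) ≡ (if S′ e then H′ v e else + 0)
    agree v e with L == e | S e
    ... | true | true = refl
    ... | true | false = refl
    ... | false | true = refl
    ... | false | false = refl
    conserved : ∀ v → boundary G S τ g v ≡ + 0
    conserved v = begin
      ∑ (m G) (λ e → if S e then H v e else + 0)                       ≡⟨ ∑≡sum (m G) _ ⟩
      ℤSum.sum (λ e → if S e then H v e else + 0)                      ≡⟨ ℤSum.sum-drop L _ ⟩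
      ℤSum.sum (λ e → if L == e then + 0 else (if S e then H v e else + 0)) ℤ.+ (if S L then H v L else + 0)
        ≡⟨ cong₂ ℤ._+_ (ℤSum.sum-cong-≋ (agree v)) (trans (cong (λ b → if b then H v L else + 0) (to T-≡ sL)) (loop-cancels v)) ⟩
      ℤSum.sum (λ e → if S′ e then H′ v e else + 0) ℤ.+ + 0          ≡⟨ ℤP.+-identityʳ _ ⟩
      ℤSum.sum (λ e → if S′ e then H′ v e else + 0)                    ≡⟨ sym (∑≡sum (m G) _) ⟩
      boundary G S′ τ′ g′ v                                            ≡⟨ conserved′ v ⟩
      + 0 ∎
      where open ≡-Reasoning

  lift : HasNZ2FlowOn G S′ → HasNZ2FlowOn G S
  lift (τ′ , g′ , oriented′ , nowhereZero′ , conserved′) = τ , g , oriented , nowhereZero , conserved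
    where open Lift τ′ g′ oriented′ nowhereZero′ conserved′

if-∧ : {A : Set} (z : A) (k s : Bool) {x : A} → (if k then (if s then x else z) else z) ≡ (if s ∧ k then x else z)
if-∧ z true true = refl
if-∧ z true false = refl
if-∧ z false true = refl
if-∧ z false false = refl

endpoints : (G : SignedGraph) (e : Fin (m G)) (β : Bool) → (src G e ≡ endOf G e β × tgt G e ≡ endOf G e (not β)) ⊎ (src G e ≡ endOf G e (not β) × tgt G e ≡ endOf G e β)
endpoints G e false = inj₁ (refl , refl)
endpoints G e true = inj₂ (refl , refl)

-- Splitting off the edges e₁ = ab and e₂ = ac at a: both are replaced by one edge bc of sign σ(e₁)σ(e₂).
module SplitOff (G : SignedGraph) (S : Fin (m G) → Bool) (a : Fin (n G)) (e₁ e₂ : Fin (m G)) (β₁ β₂ : Bool)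
                (e₁≢e₂ : e₁ ≢ e₂) (s₁ : T (S e₁)) (s₂ : T (S e₂)) (at₁ : endOf G e₁ β₁ ≡ a) (at₂ : endOf G e₂ β₂ ≡ a) where

  b c : Fin (n G)
  b = endOf G e₁ (not β₁)
  c = endOf G e₂ (not β₂)

  G′ : SignedGraph
  G′ = record { n = n G ; m = suc (m G) ; src = src′ ; tgt = tgt′ ; σ = σ′ }
    where
    src′ tgt′ : Fin (suc (m G)) → Fin (n G)
    src′ zero = b
    src′ (suc e) = src G e
    tgt′ zero = c
    tgt′ (suc e) = tgt G e
    σ′ : Fin (suc (m G)) → Sign
    σ′ zero = σ G e₁ · σ G e₂
    σ′ (suc e) = σ G e

  keep : Fin (m G) → Bool
  keep = avoid₂ e₁ e₂

  S′ : Fin (m G′) → Bool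
  S′ zero = true
  S′ (suc e) = S e ∧ keep e

  private
    S₁ : S e₁ ≡ true
    S₁ = to T-≡ s₁
    S₂ : S e₂ ≡ true
    S₂ = to T-≡ s₂

  fewer : count (m G) S ≡ suc (count (m G′) S′)
  fewer = begin
    count (m G) S                                                          ≡⟨ count≡sum (m G) S ⟩
    ℕSum.sum (λ e → ind (S e))                                             ≡⟨ ℕSum.sum-drop₂ e₁ e₂ e₁≢e₂ _ ⟩
    ℕSum.sum (λ e → if keep e then ind (S e) else 0) + ind (S e₁) + ind (S e₂)
      ≡⟨ cong₂ (λ x y → x + ind y) (cong₂ (λ x y → x + ind y) (ℕSum.sum-cong-≋ (λ e → if-∧ 0 (keep e) (S e))) S₁) S₂ ⟩
    ℕSum.sum (λ e → ind (S e ∧ keep e)) + 1 + 1                            ≡⟨ cong (λ x → x + 1 + 1) (sym (count≡sum (m G) _)) ⟩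
    count (m G) (λ e → S e ∧ keep e) + 1 + 1                               ≡⟨ solve (count (m G) (λ e → S e ∧ keep e)) ⟩
    suc (count (m G′) S′)                                                  ∎
    where
    open ≡-Reasoning
    solve : ∀ x → x + 1 + 1 ≡ suc (suc x)
    solve x = trans (ℕP.+-assoc x 1 1) (ℕP.+-comm x 2)

  private
    inc : Fin (n G) → Fin (m G) → ℕ
    inc v e = ind (src G e == v) + ind (tgt G e == v)

    inc₁ : ∀ v → inc v e₁ ≡ ind (a == v) + ind (b == v)
    inc₁ v with endpoints G e₁ β₁
    ... | inj₁ (p , q) rewrite p | q | at₁ = refl
    ... | inj₂ (p , q) rewrite p | q | at₁ = ℕP.+-comm (ind (b == v)) (ind (a == v))

    inc₂ : ∀ v → inc v e₂ ≡ ind (a == v) + ind (c == v)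
    inc₂ v with endpoints G e₂ β₂
    ... | inj₁ (p , q) rewrite p | q | at₂ = refl
    ... | inj₂ (p , q) rewrite p | q | at₂ = ℕP.+-comm (ind (c == v)) (ind (a == v))

  degree-split : ∀ v → degree G S v ≡ degree G′ S′ v + 2 * ind (a == v)
  degree-split v = begin
    degree G S v                                                          ≡⟨ ℕSum.sum-drop₂ e₁ e₂ e₁≢e₂ _ ⟩
    ℕSum.sum (λ e → if keep e then (if S e then inc v e else 0) else 0)
      + (if S e₁ then inc v e₁ else 0) + (if S e₂ then inc v e₂ else 0)
      ≡⟨ cong₂ (λ x y → x + (if y then inc v e₁ else 0) + (if S e₂ then inc v e₂ else 0)) (ℕSum.sum-cong-≋ (λ e → if-∧ 0 (keep e) (S e))) S₁ ⟩
    ℕSum.sum (λ e → if S e ∧ keep e then inc v e else 0) + inc v e₁ + (if S e₂ then inc v e₂ else 0)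
      ≡⟨ cong₂ (λ x y → ℕSum.sum (λ e → if S e ∧ keep e then inc v e else 0) + x + (if y then inc v e₂ else 0)) (inc₁ v) S₂ ⟩
    ℕSum.sum (λ e → if S e ∧ keep e then inc v e else 0) + (ind (a == v) + ind (b == v)) + inc v e₂
      ≡⟨ cong (ℕSum.sum (λ e → if S e ∧ keep e then inc v e else 0) + (ind (a == v) + ind (b == v)) ℕ.+_) (inc₂ v) ⟩
    ℕSum.sum (λ e → if S e ∧ keep e then inc v e else 0) + (ind (a == v) + ind (b == v)) + (ind (a == v) + ind (c == v))
      ≡⟨ regroup (ℕSum.sum (λ e → if S e ∧ keep e then inc v e else 0)) (ind (a == v)) (ind (b == v)) (ind (c == v)) ⟩
    degree G′ S′ v + 2 * ind (a == v)                                 ∎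
    where
    open ≡-Reasoning
    regroup : ∀ K x y z → K + (x + y) + (x + z) ≡ (y + z) + K + 2 * x
    regroup = ℕSolver.solve-∀

  evenDegrees : EvenDegrees G S → EvenDegrees G′ S′
  evenDegrees even v = ∣m+n∣m⇒∣n (subst EvenNat (trans (degree-split v) (ℕP.+-comm (degree G′ S′ v) _)) (even v)) (even-2* (ind (a == v)))

absorb : Sign → ℤ → Sign
absorb s z = if ⌊ z ℤ.≟ + 1 ⌋ then s else negate s

⟦absorb⟧ : (s : Sign) (z : ℤ) → (z ≡ + 1) ⊎ (z ≡ - (+ 1)) → ⟦ absorb s z ⟧ ≡ ⟦ s ⟧ ℤ.* z
⟦absorb⟧ s .(+ 1) (inj₁ refl) = sym (ℤP.*-identityʳ ⟦ s ⟧)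
⟦absorb⟧ plus .(- (+ 1)) (inj₂ refl) = refl
⟦absorb⟧ minus .(- (+ 1)) (inj₂ refl) = refl

-- the half-edge signs given to e₁ (or e₂): μ at the far end, -(σ μ) at a
oriented-pair : (σ μ : Sign) (β : Bool) →
                ⟦ if false xor β then μ else negate (σ · μ) ⟧ ℤ.* ⟦ if true xor β then μ else negate (σ · μ) ⟧ ≡ - ⟦ σ ⟧
oriented-pair plus plus false = refl
oriented-pair plus minus false = refl
oriented-pair minus plus false = refl
oriented-pair minus minus false = refl
oriented-pair plus plus true = refl
oriented-pair plus minus true = refl
oriented-pair minus plus true = refl
oriented-pair minus minus true = refl

cancel-at-a : (σ₁ σ₂ μ ν : Sign) → ⟦ μ ⟧ ℤ.* ⟦ ν ⟧ ≡ - ⟦ σ₁ · σ₂ ⟧ → ⟦ negate (σ₁ · μ) ⟧ ℤ.+ ⟦ negate (σ₂ · ν) ⟧ ≡ + 0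
cancel-at-a plus plus plus plus ()
cancel-at-a plus plus plus minus _ = refl
cancel-at-a plus plus minus plus _ = refl
cancel-at-a plus plus minus minus ()
cancel-at-a plus minus plus plus _ = refl
cancel-at-a plus minus plus minus ()
cancel-at-a plus minus minus plus ()
cancel-at-a plus minus minus minus _ = refl
cancel-at-a minus plus plus plus _ = refl
cancel-at-a minus plus plus minus ()
cancel-at-a minus plus minus plus ()
cancel-at-a minus plus minus minus _ = refl
cancel-at-a minus minus plus plus ()
cancel-at-a minus minus plus minus _ = refl
cancel-at-a minus minus minus plus _ = refl
cancel-at-a minus minus minus minus ()

module SplitOffLift (G : SignedGraph) (S : Fin (m G) → Bool) (a : Fin (n G)) (e₁ e₂ : Fin (m G)) (β₁ β₂ : Bool)
                    (e₁≢e₂ : e₁ ≢ e₂) (s₁ : T (S e₁)) (s₂ : T (S e₂)) (at₁ : endOf G e₁ β₁ ≡ a) (at₂ : endOf G e₂ β₂ ≡ a) where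

  open SplitOff G S a e₁ e₂ β₁ β₂ e₁≢e₂ s₁ s₂ at₁ at₂

  private
    ite : Bool → ℤ → ℤ
    ite x p = if x then p else + 0

    unit-square : ∀ z → (z ≡ + 1) ⊎ (z ≡ - (+ 1)) → z ℤ.* z ≡ + 1
    unit-square .(+ 1) (inj₁ refl) = refl
    unit-square .(- (+ 1)) (inj₂ refl) = refl

  module Lift (τ′ : Orientation G′) (g′ : Fin (m G′) → ℤ) (oriented′ : IsOrientationOn G′ S′ τ′)
              (nowhereZero′ : ∀ e → T (S′ e) → (g′ e ≡ + 1) ⊎ (g′ e ≡ - (+ 1))) (conserved′ : ∀ v → boundary G′ S′ τ′ g′ v ≡ + 0) where
    unit₀ = nowhereZero′ zero tt
    μ ν : Sign
    μ = absorb (τ′ zero false) (g′ zero)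
    ν = absorb (τ′ zero true) (g′ zero)
    σ₁ = σ G e₁
    σ₂ = σ G e₂
    τ : Orientation G
    τ e x = if e₁ == e then (if x xor β₁ then μ else negate (σ₁ · μ))
            else if e₂ == e then (if x xor β₂ then ν else negate (σ₂ · ν)) else τ′ (suc e) x
    g : Fin (m G) → ℤ
    g e = if e₁ == e then + 1 else if e₂ == e then + 1 else g′ (suc e)
    e₁≠e₂ : (e₁ == e₂) ≡ false
    e₁≠e₂ = ==-≢ e₁≢e₂
    kept : ∀ e → keep e ≡ true → ((e₁ == e) ≡ false) × ((e₂ == e) ≡ false)
    kept e k with e₁ == e | e₂ == e
    ... | false | false = refl , refl
    in-S′ : ∀ e → T (S e) → (e₁ == e) ≡ false → (e₂ == e) ≡ false → T (S′ (suc e))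
    in-S′ e s n₁ n₂ rewrite n₁ | n₂ = from (T-∧ {S e}) (s , tt)
    μν : ⟦ μ ⟧ ℤ.* ⟦ ν ⟧ ≡ - ⟦ σ₁ · σ₂ ⟧
    μν = begin
      ⟦ μ ⟧ ℤ.* ⟦ ν ⟧                                          ≡⟨ cong₂ ℤ._*_ (⟦absorb⟧ (τ′ zero false) (g′ zero) unit₀) (⟦absorb⟧ (τ′ zero true) (g′ zero) unit₀) ⟩
      (⟦ τ′ zero false ⟧ ℤ.* g′ zero) ℤ.* (⟦ τ′ zero true ⟧ ℤ.* g′ zero) ≡⟨ regroup ⟦ τ′ zero false ⟧ ⟦ τ′ zero true ⟧ (g′ zero) ⟩
      ⟦ τ′ zero false ⟧ ℤ.* ⟦ τ′ zero true ⟧ ℤ.* (g′ zero ℤ.* g′ zero) ≡⟨ cong (⟦ τ′ zero false ⟧ ℤ.* ⟦ τ′ zero true ⟧ ℤ.*_) (unit-square (g′ zero) unit₀) ⟩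
      ⟦ τ′ zero false ⟧ ℤ.* ⟦ τ′ zero true ⟧ ℤ.* + 1             ≡⟨ ℤP.*-identityʳ _ ⟩
      ⟦ τ′ zero false ⟧ ℤ.* ⟦ τ′ zero true ⟧                     ≡⟨ oriented′ zero tt ⟩
      - ⟦ σ₁ · σ₂ ⟧                                              ∎
      where
      open ≡-Reasoning
      regroup : ∀ (x y z : ℤ) → (x ℤ.* z) ℤ.* (y ℤ.* z) ≡ x ℤ.* y ℤ.* (z ℤ.* z)
      regroup = ℤSolver.solve-∀
    oriented : IsOrientationOn G S τ
    oriented e s with e₁ == e in q₁ | e₂ == e in q₂
    ... | true | _ rewrite sym (toWitness (subst T (sym q₁) tt)) = oriented-pair σ₁ μ β₁
    ... | false | true rewrite sym (toWitness (subst T (sym q₂) tt)) = oriented-pair σ₂ ν β₂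
    ... | false | false = oriented′ (suc e) (in-S′ e s q₁ q₂)
    nowhereZero : ∀ e → T (S e) → (g e ≡ + 1) ⊎ (g e ≡ - (+ 1))
    nowhereZero e s with e₁ == e in q₁ | e₂ == e in q₂
    ... | true | _ = inj₁ refl
    ... | false | true = inj₁ refl
    ... | false | false = nowhereZero′ (suc e) (in-S′ e s q₁ q₂)
    H : Fin (n G) → Fin (m G) → ℤ
    H v e = half G τ g v e false ℤ.+ half G τ g v e true
    H′ : Fin (n G) → Fin (m G′) → ℤ
    H′ v e = half G′ τ′ g′ v e false ℤ.+ half G′ τ′ g′ v e true
    at-split-edge : (e : Fin (m G)) (β : Bool) (M N : Sign) (v : Fin (n G)) → (∀ x → τ e x ≡ (if x xor β then M else N)) → g e ≡ + 1 →
                    H v e ≡ ite (endOf G e β == v) ⟦ N ⟧ ℤ.+ ite (endOf G e (not β) == v) ⟦ M ⟧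
    at-split-edge e false M N v τ≡ g≡ rewrite τ≡ false | τ≡ true | g≡ | ℤP.*-identityʳ ⟦ N ⟧ | ℤP.*-identityʳ ⟦ M ⟧ = refl
    at-split-edge e true M N v τ≡ g≡ rewrite τ≡ false | τ≡ true | g≡ | ℤP.*-identityʳ ⟦ N ⟧ | ℤP.*-identityʳ ⟦ M ⟧ =
      ℤP.+-comm (ite (src G e == v) ⟦ M ⟧) (ite (tgt G e == v) ⟦ N ⟧)
    τ₁ : ∀ x → τ e₁ x ≡ (if x xor β₁ then μ else negate (σ₁ · μ))
    τ₁ x rewrite ==-refl e₁ = refl
    g₁ : g e₁ ≡ + 1
    g₁ rewrite ==-refl e₁ = refl
    τ₂ : ∀ x → τ e₂ x ≡ (if x xor β₂ then ν else negate (σ₂ · ν))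
    τ₂ x rewrite e₁≠e₂ | ==-refl e₂ = refl
    g₂ : g e₂ ≡ + 1
    g₂ rewrite e₁≠e₂ | ==-refl e₂ = refl
    H₁ : ∀ v → H v e₁ ≡ ite (a == v) ⟦ negate (σ₁ · μ) ⟧ ℤ.+ ite (b == v) ⟦ μ ⟧
    H₁ v = trans (at-split-edge e₁ β₁ μ (negate (σ₁ · μ)) v τ₁ g₁)
                 (cong (λ z → ite (z == v) ⟦ negate (σ₁ · μ) ⟧ ℤ.+ ite (b == v) ⟦ μ ⟧) at₁)
    H₂ : ∀ v → H v e₂ ≡ ite (a == v) ⟦ negate (σ₂ · ν) ⟧ ℤ.+ ite (c == v) ⟦ ν ⟧
    H₂ v = trans (at-split-edge e₂ β₂ ν (negate (σ₂ · ν)) v τ₂ g₂)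
                 (cong (λ z → ite (z == v) ⟦ negate (σ₂ · ν) ⟧ ℤ.+ ite (c == v) ⟦ ν ⟧) at₂)
    H′₀ : ∀ v → H′ v zero ≡ ite (b == v) ⟦ μ ⟧ ℤ.+ ite (c == v) ⟦ ν ⟧
    H′₀ v = cong₂ ℤ._+_ (cong (ite (b == v)) (sym (⟦absorb⟧ (τ′ zero false) (g′ zero) unit₀)))
                        (cong (ite (c == v)) (sym (⟦absorb⟧ (τ′ zero true) (g′ zero) unit₀)))
    local : ∀ v → H v e₁ ℤ.+ H v e₂ ≡ H′ v zero
    local v = trans (cong₂ ℤ._+_ (H₁ v) (H₂ v)) (trans (at-a (a == v) (b == v) (c == v)) (sym (H′₀ v)))
      where
      A₁ = ⟦ negate (σ₁ · μ) ⟧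
      A₂ = ⟦ negate (σ₂ · ν) ⟧
      at-a : ∀ xa xb xc → (ite xa A₁ ℤ.+ ite xb ⟦ μ ⟧) ℤ.+ (ite xa A₂ ℤ.+ ite xc ⟦ ν ⟧) ≡ ite xb ⟦ μ ⟧ ℤ.+ ite xc ⟦ ν ⟧
      at-a true xb xc = trans (regroup A₁ (ite xb ⟦ μ ⟧) A₂ (ite xc ⟦ ν ⟧))
                              (trans (cong (ℤ._+ (ite xb ⟦ μ ⟧ ℤ.+ ite xc ⟦ ν ⟧)) (cancel-at-a σ₁ σ₂ μ ν μν)) (ℤP.+-identityˡ _))
        where
        regroup : ∀ (p q r t : ℤ) → (p ℤ.+ q) ℤ.+ (r ℤ.+ t) ≡ (p ℤ.+ r) ℤ.+ (q ℤ.+ t)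
        regroup = ℤSolver.solve-∀
      at-a false xb xc = cong₂ ℤ._+_ (ℤP.+-identityˡ (ite xb ⟦ μ ⟧)) (ℤP.+-identityˡ (ite xc ⟦ ν ⟧))
    agree : ∀ v e → (if keep e then (if S e then H v e else + 0) else + 0) ≡ (if S e ∧ keep e then H′ v (suc e) else + 0)
    agree v e with keep e in k | S e
    ... | false | true = refl
    ... | false | false = refl
    ... | true | false = refl
    ... | true | true rewrite proj₁ (kept e k) | proj₂ (kept e k) = refl
    conserved : ∀ v → boundary G S τ g v ≡ + 0
    conserved v = begin
      ∑ (m G) (λ e → if S e then H v e else + 0)                           ≡⟨ ∑≡sum (m G) _ ⟩
      ℤSum.sum (λ e → if S e then H v e else + 0)                          ≡⟨ ℤSum.sum-drop₂ e₁ e₂ e₁≢e₂ _ ⟩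
      ℤSum.sum (λ e → if keep e then (if S e then H v e else + 0) else + 0) ℤ.+ (if S e₁ then H v e₁ else + 0) ℤ.+ (if S e₂ then H v e₂ else + 0)
        ≡⟨ cong₂ (λ x y → ℤSum.sum (λ e → if keep e then (if S e then H v e else + 0) else + 0) ℤ.+ (if x then H v e₁ else + 0) ℤ.+ (if y then H v e₂ else + 0))
                 (to T-≡ s₁) (to T-≡ s₂) ⟩
      ℤSum.sum (λ e → if keep e then (if S e then H v e else + 0) else + 0) ℤ.+ H v e₁ ℤ.+ H v e₂
        ≡⟨ ℤP.+-assoc (ℤSum.sum (λ e → if keep e then (if S e then H v e else + 0) else + 0)) (H v e₁) (H v e₂) ⟩
      ℤSum.sum (λ e → if keep e then (if S e then H v e else + 0) else + 0) ℤ.+ (H v e₁ ℤ.+ H v e₂)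
        ≡⟨ cong₂ ℤ._+_ (ℤSum.sum-cong-≋ (agree v)) (local v) ⟩
      ℤSum.sum (λ e → if S e ∧ keep e then H′ v (suc e) else + 0) ℤ.+ H′ v zero
        ≡⟨ ℤP.+-comm _ (H′ v zero) ⟩
      H′ v zero ℤ.+ ℤSum.sum (λ e → if S e ∧ keep e then H′ v (suc e) else + 0)
        ≡⟨ cong (λ s → H′ v zero ℤ.+ s) (sym (∑≡sum (m G) _)) ⟩
      boundary G′ S′ τ′ g′ v                                                ≡⟨ conserved′ v ⟩
      + 0                                                                   ∎
      where open ≡-Reasoning

  lift : HasNZ2FlowOn G′ S′ → HasNZ2FlowOn G S
  lift (τ′ , g′ , oriented′ , nowhereZero′ , conserved′) = τ , g , oriented , nowhereZero , conserved
    where open Lift τ′ g′ oriented′ nowhereZero′ conserved′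

merge-parity : (K : ℕ) (x y : Bool) → EvenNat (K + ind x + ind y) → EvenNat (ind (x xor y) + K)
merge-parity K x y even = ∣m+n∣m⇒∣n (subst EvenNat regroup even) (even-2* (ind (x ∧ y)))
  where
  regroup : K + ind x + ind y ≡ 2 * ind (x ∧ y) + (ind (x xor y) + K)
  regroup = trans (ℕP.+-assoc K (ind x) (ind y)) (trans (cong (λ y → K + y) (ind-+ x y)) (shuffle K (ind (x xor y)) (ind (x ∧ y))))
    where
    shuffle : ∀ k p q → k + (p + 2 * q) ≡ 2 * q + (p + k)
    shuffle = ℕSolver.solve-∀

Avoiding : (G : SignedGraph) → (Fin (m G) → Bool) → Fin (n G) → Fin (m G) → Bool
Avoiding G S a e = S e ∧ not (src G e == a) ∧ not (tgt G e == a)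

module SplitOffClosedSets (G : SignedGraph) (S : Fin (m G) → Bool) (a : Fin (n G)) (e₁ e₂ : Fin (m G)) (β₁ β₂ : Bool)
                          (e₁≢e₂ : e₁ ≢ e₂) (s₁ : T (S e₁)) (s₂ : T (S e₂)) (at₁ : endOf G e₁ β₁ ≡ a) (at₂ : endOf G e₂ β₂ ≡ a) where

  open SplitOff G S a e₁ e₂ β₁ β₂ e₁≢e₂ s₁ s₂ at₁ at₂

  -- Conditions under which splitting off keeps every closed set even.
  data Safe : Set where
    b-is-a    : b ≡ a → Safe
    c-is-a    : c ≡ a → Safe
    only-two  : (∀ e → T (S e) → e ≢ e₁ → e ≢ e₂ → (src G e ≢ a) × (tgt G e ≢ a)) → Safe
    reconnect : (e₃ : Fin (m G)) (x : Fin (n G)) → T (S e₃) → e₃ ≢ e₁ → e₃ ≢ e₂ → Joins G e₃ a x → Reach G (Avoiding G S a) b x → Safe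

  private
    n₁ = isNeg (σ G e₁)
    n₂ = isNeg (σ G e₂)

    keep-true : ∀ e → e ≢ e₁ → e ≢ e₂ → keep e ≡ true
    keep-true e n₁ n₂ rewrite ==-≢ (λ q → n₁ (sym q)) | ==-≢ (λ q → n₂ (sym q)) = refl

    keep-false : ∀ e → keep e ≡ false → (e ≡ e₁) ⊎ (e ≡ e₂)
    keep-false e k with e₁ == e in q₁ | e₂ == e in q₂
    ... | true | _ = inj₁ (sym (toWitness (subst T (sym q₁) tt)))
    ... | false | true = inj₂ (sym (toWitness (subst T (sym q₂) tt)))

    keep-e₁ : keep e₁ ≡ false
    keep-e₁ rewrite ==-refl e₁ = refl

    keep-e₂ : keep e₂ ≡ false
    keep-e₂ rewrite ==-refl e₂ = ∧-zeroʳ (not (e₁ == e₂))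

    kept⇒≢ : ∀ e → keep e ≡ true → (e ≢ e₁) × (e ≢ e₂)
    kept⇒≢ e k = (λ { refl → false≢true (trans (sym keep-e₁) k) }) , (λ { refl → false≢true (trans (sym keep-e₂) k) })
      where
      false≢true : false ≢ true
      false≢true ()

    closed-kept : ∀ U → ClosedUnder G′ S′ U → ∀ e → T (S e) → keep e ≡ true → U (src G e) ≡ U (tgt G e)
    closed-kept U closed e s k = closed (suc e) (from (T-∧ {S e}) (s , subst T (sym k) tt))

    closed-new : ∀ U → ClosedUnder G′ S′ U → U b ≡ U c
    closed-new U closed = closed zero tt

    touches : (e : Fin (m G)) (β : Bool) → endOf G e β ≡ a → (src G e ≡ a) ⊎ (tgt G e ≡ a)
    touches e false at = inj₁ at
    touches e true at = inj₂ at

    along : (U : Fin (n G) → Bool) (e : Fin (m G)) (β : Bool) → endOf G e β ≡ a → U a ≡ U (endOf G e (not β)) →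
            U (src G e) ≡ U (tgt G e)
    along U e false at eq = trans (cong U at) eq
    along U e true at eq = sym (trans (cong U at) eq)

    closed-before : ∀ U → ClosedUnder G′ S′ U → U a ≡ U b → ClosedUnder G S U
    closed-before U closed ab e s with keep e in k
    ... | true = closed-kept U closed e s k
    ... | false with keep-false e k
    ...   | inj₁ refl = along U e₁ β₁ at₁ ab
    ...   | inj₂ refl = along U e₂ β₂ at₂ (trans ab (closed-new U closed))

    inside : (Fin (n G) → Bool) → Fin (m G) → Bool
    inside U e = S e ∧ U (src G e) ∧ U (tgt G e) ∧ isNeg (σ G e)

    rest : (Fin (n G) → Bool) → ℕ
    rest U = ℕSum.sum (λ e → if keep e then ind (inside U e) else 0)

    inside₁ : ∀ U → inside U e₁ ≡ (U a ∧ U b ∧ n₁)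
    inside₁ U rewrite to T-≡ s₁ with endpoints G e₁ β₁
    ... | inj₁ (p , q) rewrite p | q | at₁ = refl
    ... | inj₂ (p , q) rewrite p | q | at₁ = swap (U b) (U a) n₁
      where
      swap : ∀ x y z → (x ∧ y ∧ z) ≡ (y ∧ x ∧ z)
      swap true true z = refl
      swap true false z = refl
      swap false true z = refl
      swap false false z = refl

    inside₂ : ∀ U → inside U e₂ ≡ (U a ∧ U c ∧ n₂)
    inside₂ U rewrite to T-≡ s₂ with endpoints G e₂ β₂
    ... | inj₁ (p , q) rewrite p | q | at₂ = refl
    ... | inj₂ (p , q) rewrite p | q | at₂ = swap (U c) (U a) n₂
      where
      swap : ∀ x y z → (x ∧ y ∧ z) ≡ (y ∧ x ∧ z)
      swap true true z = refl
      swap true false z = refl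
      swap false true z = refl
      swap false false z = refl

    negInside-before : ∀ U → negInside G S U ≡ rest U + ind (U a ∧ U b ∧ n₁) + ind (U a ∧ U c ∧ n₂)
    negInside-before U = trans (count≡sum (m G) (inside U))
      (trans (ℕSum.sum-drop₂ e₁ e₂ e₁≢e₂ _) (cong₂ (λ x y → rest U + ind x + ind y) (inside₁ U) (inside₂ U)))

    negInside-after : ∀ U → negInside G′ S′ U ≡ ind (U b ∧ U c ∧ (n₁ xor n₂)) + rest U
    negInside-after U = cong₂ _+_ (cong (λ z → ind (U b ∧ U c ∧ z)) (isNeg-· (σ G e₁) (σ G e₂)))
                                  (trans (count≡sum (m G) _) (ℕSum.sum-cong-≋ λ e → sym (trans (if-∧ 0 (keep e) (inside U e)) (cong ind (reorder (S e) (keep e))))))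
      where
      reorder : ∀ s k {r : Bool} → ((s ∧ r) ∧ k) ≡ ((s ∧ k) ∧ r)
      reorder true true = ∧-identityʳ _
      reorder true false = ∧-zeroʳ _
      reorder false k = refl

    when-a≡b : EvenOnClosedSets G S → ∀ U → ClosedUnder G′ S′ U → U a ≡ U b → EvenNat (negInside G′ S′ U)
    when-a≡b even U closed ab =
      subst EvenNat (sym (negInside-after U))
        (merge (U a) (U b) (U c) ab (trans ab (closed-new U closed)) (subst EvenNat (negInside-before U) (even U (closed-before U closed ab))))
      where
      merge : ∀ xa xb xc → xa ≡ xb → xa ≡ xc → EvenNat (rest U + ind (xa ∧ xb ∧ n₁) + ind (xa ∧ xc ∧ n₂)) →
              EvenNat (ind (xb ∧ xc ∧ (n₁ xor n₂)) + rest U)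
      merge true .true .true refl refl = merge-parity (rest U) n₁ n₂
      merge false .false .false refl refl = merge-parity (rest U) false false

    false≢true : false ≢ true
    false≢true ()

    -- when e₁, e₂ are the only edges at a, adding a to U gives a set closed before the split
    when-a-has-degree-two : EvenOnClosedSets G S → (∀ e → T (S e) → e ≢ e₁ → e ≢ e₂ → (src G e ≢ a) × (tgt G e ≢ a)) →
                            ∀ U → ClosedUnder G′ S′ U → U b ≡ true → EvenNat (negInside G′ S′ U)
    when-a-has-degree-two even others-avoid-a U closed b∈ =
      subst EvenNat (sym (negInside-after U))
        (subst₂ (λ x y → EvenNat (ind (x ∧ y ∧ (n₁ xor n₂)) + rest U)) (sym b∈) c∈
          (merge-parity (rest U) n₁ n₂ (subst EvenNat count-with-a (even U⁺ closed⁺))))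
      where
      c∈ : true ≡ U c
      c∈ = trans (sym b∈) (closed-new U closed)
      U⁺ : Fin (n G) → Bool
      U⁺ x = U x ∨ (a == x)
      U⁺-away : ∀ x → x ≢ a → U⁺ x ≡ U x
      U⁺-away x x≢a = trans (cong (U x ∨_) (==-≢ (λ p → x≢a (sym p)))) (∨-identityʳ (U x))
      U⁺a : U⁺ a ≡ true
      U⁺a = trans (cong (U a ∨_) (==-refl a)) (∨-zeroʳ (U a))
      U⁺b : U⁺ b ≡ true
      U⁺b = cong (_∨ (a == b)) b∈
      U⁺c : U⁺ c ≡ true
      U⁺c = cong (_∨ (a == c)) (sym c∈)
      closed⁺ : ClosedUnder G S U⁺
      closed⁺ e s with keep e in k
      ... | true = let (src≢a , tgt≢a) = others-avoid-a e s (proj₁ (kept⇒≢ e k)) (proj₂ (kept⇒≢ e k))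
                   in trans (U⁺-away (src G e) src≢a) (trans (closed-kept U closed e s k) (sym (U⁺-away (tgt G e) tgt≢a)))
      ... | false with keep-false e k
      ...   | inj₁ refl = along U⁺ e₁ β₁ at₁ (trans U⁺a (sym U⁺b))
      ...   | inj₂ refl = along U⁺ e₂ β₂ at₂ (trans U⁺a (sym U⁺c))
      same-rest : rest U⁺ ≡ rest U
      same-rest = ℕSum.sum-cong-≋ agree
        where
        agree : ∀ e → (if keep e then ind (inside U⁺ e) else 0) ≡ (if keep e then ind (inside U e) else 0)
        agree e with keep e in k | S e in se
        ... | false | _ = refl
        ... | true | false = refl
        ... | true | true = let (src≢a , tgt≢a) = others-avoid-a e (subst T (sym se) tt) (proj₁ (kept⇒≢ e k)) (proj₂ (kept⇒≢ e k))
                            in cong₂ (λ x y → ind (x ∧ y ∧ isNeg (σ G e))) (U⁺-away (src G e) src≢a) (U⁺-away (tgt G e) tgt≢a)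
      count-with-a : negInside G S U⁺ ≡ rest U + ind n₁ + ind n₂
      count-with-a = begin
        negInside G S U⁺                                                        ≡⟨ negInside-before U⁺ ⟩
        rest U⁺ + ind (U⁺ a ∧ U⁺ b ∧ n₁) + ind (U⁺ a ∧ U⁺ c ∧ n₂)             ≡⟨ cong₂ (λ r x → r + x + ind (U⁺ a ∧ U⁺ c ∧ n₂)) same-rest
                                                                                   (cong₂ (λ x y → ind (x ∧ y ∧ n₁)) U⁺a U⁺b) ⟩
        rest U + ind n₁ + ind (U⁺ a ∧ U⁺ c ∧ n₂)                                ≡⟨ cong (λ x → rest U + ind n₁ + x) (cong₂ (λ x y → ind (x ∧ y ∧ n₂)) U⁺a U⁺c) ⟩
        rest U + ind n₁ + ind n₂                                                ∎
        where open ≡-Reasoning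

    -- Apart from the degree-two case, such a U contradicts closedness.
    when-b-without-a : EvenOnClosedSets G S → Safe → ∀ U → ClosedUnder G′ S′ U → U a ≡ false → U b ≡ true → EvenNat (negInside G′ S′ U)
    when-b-without-a even (b-is-a b≡a) U closed a∉ b∈ = ⊥-elim (false≢true (trans (sym a∉) (trans (cong U (sym b≡a)) b∈)))
    when-b-without-a even (c-is-a c≡a) U closed a∉ b∈ =
      ⊥-elim (false≢true (trans (sym a∉) (trans (cong U (sym c≡a)) (trans (sym (closed-new U closed)) b∈))))
    when-b-without-a even (reconnect e₃ x s₃ e₃≢e₁ e₃≢e₂ a–x b⇝x) U closed a∉ b∈ =
      ⊥-elim (false≢true (trans (sym a∉) (trans (sym (x~a a–x)) (trans (sym b~x) b∈))))
      where
      x~a : Joins G e₃ a x → U x ≡ U a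
      x~a (inj₁ (p , q)) = trans (cong U (sym q)) (trans (sym (closed-kept U closed e₃ s₃ (keep-true e₃ e₃≢e₁ e₃≢e₂))) (cong U p))
      x~a (inj₂ (p , q)) = trans (cong U (sym p)) (trans (closed-kept U closed e₃ s₃ (keep-true e₃ e₃≢e₁ e₃≢e₂)) (cong U q))
      avoid-closed : ClosedUnder G (Avoiding G S a) U
      avoid-closed e h = closed-kept U closed e s (keep-true e (λ { refl → misses (touches e₁ β₁ at₁) }) (λ { refl → misses (touches e₂ β₂ at₂) }))
        where
        s = proj₁ (to (T-∧ {S e}) h)
        away = to (T-∧ {not (src G e == a)}) (proj₂ (to (T-∧ {S e}) h))
        misses : (src G e ≡ a) ⊎ (tgt G e ≡ a) → Data.Empty.⊥
        misses (inj₁ p) = subst T (trans (cong (λ z → not (z == a)) p) (cong not (==-refl a))) (proj₁ away)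
        misses (inj₂ p) = subst T (trans (cong (λ z → not (z == a)) p) (cong not (==-refl a))) (proj₂ away)
      b~x : U b ≡ U x
      b~x = ClosedUnder-Reach U avoid-closed b⇝x
    when-b-without-a even (only-two others-avoid-a) U closed a∉ b∈ = when-a-has-degree-two even others-avoid-a U closed b∈

  evenOnClosedSets : EvenOnClosedSets G S → Safe → EvenOnClosedSets G′ S′
  evenOnClosedSets even safe U closed = by-cases (U a) (U b) refl refl
    where
    by-cases : ∀ xa xb → U a ≡ xa → U b ≡ xb → EvenNat (negInside G′ S′ U)
    by-cases true true ua ub = when-a≡b even U closed (trans ua (sym ub))
    by-cases false false ua ub = when-a≡b even U closed (trans ua (sym ub))
    by-cases false true ua ub = when-b-without-a even safe U closed ua ub
    by-cases true false ua ub = ∣m+n∣m⇒∣n (subst EvenNat (trans (sym partition) (ℕP.+-comm (negInside G′ S′ U) _)) evenAll) evenᶜ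
      where
      Uᶜ : Fin (n G) → Bool
      Uᶜ x = not (U x)
      evenᶜ : EvenNat (negInside G′ S′ Uᶜ)
      evenᶜ = when-b-without-a even safe Uᶜ (λ e s → cong not (closed e s)) (cong not ua) (cong not ub)
      evenAll : EvenNat (negInside G′ S′ (λ _ → true))
      evenAll = when-a≡b even (λ _ → true) (λ _ _ → refl) refl
      partition : negInside G′ S′ U + negInside G′ S′ Uᶜ ≡ negInside G′ S′ (λ _ → true)
      partition = count-+ (m G′) (insideAfter U) (insideAfter Uᶜ) (insideAfter (λ _ → true)) per-edge
        where
        insideAfter : (Fin (n G) → Bool) → Fin (m G′) → Bool
        insideAfter V e = S′ e ∧ V (src G′ e) ∧ V (tgt G′ e) ∧ isNeg (σ G′ e)
        per-edge : ∀ e → ind (insideAfter U e) + ind (insideAfter Uᶜ e) ≡ ind (insideAfter (λ _ → true) e)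
        per-edge e with S′ e in s
        ... | false = refl
        ... | true rewrite closed e (subst T (sym s) tt) with U (tgt G′ e) | isNeg (σ G′ e)
        ...   | true | true = refl
        ...   | true | false = refl
        ...   | false | true = refl
        ...   | false | false = refl

emptyFlow : (G : SignedGraph) (S : Fin (m G) → Bool) → (∀ e → ¬ T (S e)) → HasNZ2FlowOn G S
emptyFlow G S none = (λ _ _ → plus) , (λ _ → + 1) , (λ e s → ⊥-elim (none e s)) , (λ e s → ⊥-elim (none e s)) ,
  λ v → trans (∑-cong (m G) (λ e → cong (λ b → if b then _ else + 0) (¬T⇒≡false (none e)))) (∑-zero (m G))

Touches : (G : SignedGraph) → Fin (n G) → Fin (m G) → Set
Touches G a e = (src G e ≡ a) ⊎ (tgt G e ≡ a)

touches? : (G : SignedGraph) (a : Fin (n G)) (e : Fin (m G)) → Dec (Touches G a e)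
touches? G a e = (src G e ≟ a) ⊎-dec (tgt G e ≟ a)

touching-end : (G : SignedGraph) (a : Fin (n G)) (e : Fin (m G)) → Touches G a e → Σ Bool λ β → endOf G e β ≡ a
touching-end G a e (inj₁ p) = false , p
touching-end G a e (inj₂ p) = true , p

NZ2FlowsUpTo : ℕ → Set
NZ2FlowsUpTo k = ∀ (G : SignedGraph) (S : Fin (m G) → Bool) → count (m G) S ≤ k → EvenDegrees G S → EvenOnClosedSets G S → HasNZ2FlowOn G S

-- One reduction step at the tail a of an edge e₀: remove a positive loop at a, or split off two edges at a.
module Reduce (k : ℕ) (smaller : NZ2FlowsUpTo k) (G : SignedGraph) (S : Fin (m G) → Bool) (bound : count (m G) S ≤ suc k)
              (evenDegrees : EvenDegrees G S) (evenClosed : EvenOnClosedSets G S) (e₀ : Fin (m G)) (s₀ : T (S e₀)) where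

  a : Fin (n G)
  a = src G e₀

  split : (e₁ e₂ : Fin (m G)) (β₁ β₂ : Bool) (e₁≢e₂ : e₁ ≢ e₂) (s₁ : T (S e₁)) (s₂ : T (S e₂))
          (at₁ : endOf G e₁ β₁ ≡ a) (at₂ : endOf G e₂ β₂ ≡ a) →
          SplitOffClosedSets.Safe G S a e₁ e₂ β₁ β₂ e₁≢e₂ s₁ s₂ at₁ at₂ → HasNZ2FlowOn G S
  split e₁ e₂ β₁ β₂ e₁≢e₂ s₁ s₂ at₁ at₂ safe =
    SplitOffLift.lift G S a e₁ e₂ β₁ β₂ e₁≢e₂ s₁ s₂ at₁ at₂
      (smaller G′ S′ (ℕP.≤-pred (subst (_≤ suc k) fewer bound)) (evenDegrees′ evenDegrees)
               (SplitOffClosedSets.evenOnClosedSets G S a e₁ e₂ β₁ β₂ e₁≢e₂ s₁ s₂ at₁ at₂ evenClosed safe))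
    where
    open SplitOff G S a e₁ e₂ β₁ β₂ e₁≢e₂ s₁ s₂ at₁ at₂ renaming (evenDegrees to evenDegrees′)

  private
    ≢-from-¬== : ∀ {x y : Fin (m G)} → T (not (x == y)) → x ≢ y
    ≢-from-¬== h refl = subst T (cong not (==-refl _)) h

    another-edge? : (excluded : Fin (m G) → Set) → (∀ e → Dec (excluded e)) →
                    Dec (∃ λ e → T (S e) × ¬ excluded e × Touches G a e)
    another-edge? excluded excluded? = FP.any? (λ e → T? (S e) ×-dec ¬? (excluded? e) ×-dec touches? G a e)

  -- Were L the only edge at a, {a} would be a closed set with a single negative edge.
  negativeLoop : (L : Fin (m G)) → T (S L) → src G L ≡ a → tgt G L ≡ a → σ G L ≡ minus → HasNZ2FlowOn G S
  negativeLoop L sL srcL tgtL negative with another-edge? (L ≡_) (L ≟_)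
  ... | yes (e₂ , s₂ , L≢e₂ , touches) =
        split L e₂ false (proj₁ (touching-end G a e₂ touches)) L≢e₂ sL s₂ srcL (proj₂ (touching-end G a e₂ touches))
              (SplitOffClosedSets.b-is-a tgtL)
  ... | no none = ⊥-elim (odd-1 (subst EvenNat just-L (evenClosed U U-closed)))
    where
    U : Fin (n G) → Bool
    U x = a == x
    away : ∀ e → T (S e) → L ≢ e → (src G e ≢ a) × (tgt G e ≢ a)
    away e s L≢e = (λ p → none (e , s , L≢e , inj₁ p)) , (λ p → none (e , s , L≢e , inj₂ p))
    U-closed : ClosedUnder G S U
    U-closed e s with L ≟ e
    ... | yes refl = cong U (trans srcL (sym tgtL))
    ... | no L≢e = trans (==-≢ (λ p → proj₁ (away e s L≢e) (sym p))) (sym (==-≢ (λ p → proj₂ (away e s L≢e) (sym p))))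
    only-L : ∀ e → (S e ∧ U (src G e) ∧ U (tgt G e) ∧ isNeg (σ G e)) ≡ (L == e)
    only-L e with L ≟ e
    ... | yes refl rewrite to T-≡ sL | srcL | tgtL | ==-refl a | negative = refl
    ... | no L≢e with S e in se
    ...   | false = refl
    ...   | true rewrite ==-≢ (λ p → proj₁ (away e (subst T (sym se) tt) L≢e) (sym p)) = refl
    just-L : negInside G S U ≡ 1
    just-L = trans (count-cong (m G) only-L) (trans (count≡sum (m G) (L ==_)) (ℕSum.sum-pick L (λ _ → 1)))

  -- Without loops at a, let B be what the far end b₀ of e₀ reaches avoiding a. The S-edges
  -- leaving B are exactly the edges between a and B, and there is an even number of them, so
  -- besides e₀ there is an edge e₁ from a into B. Splitting e₀ with a third edge at a keeps a
  -- connected to B through e₁; if there is none, a has degree two and e₀, e₁ are split off.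
  module WithoutLoop (noLoop : ∀ L → T (S L) → src G L ≡ a → tgt G L ≢ a) where

    b₀ = tgt G e₀
    A = Avoiding G S a
    B : Fin (n G) → Bool
    B x = ⌊ Reach? {G} {A} b₀ x ⌋
    avoids : ∀ e → T (A e) → (src G e ≢ a) × (tgt G e ≢ a)
    avoids e h = (λ p → subst T (trans (cong (λ z → not (z == a)) p) (cong not (==-refl a))) (proj₁ away))
               , (λ p → subst T (trans (cong (λ z → not (z == a)) p) (cong not (==-refl a))) (proj₂ away))
      where
      away = to (T-∧ {not (src G e == a)}) (proj₂ (to (T-∧ {S e}) h))
    a∉B : B a ≡ false
    a∉B = ¬T⇒≡false (λ h → noLoop e₀ s₀ refl (reaches-a (toWitness h) refl))
      where
      reaches-a : ∀ {x y} → Reach G A x y → y ≡ a → x ≡ a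
      reaches-a here eq = eq
      reaches-a (step e r s (inj₁ (_ , q))) eq = ⊥-elim (proj₂ (avoids e s) (trans q eq))
      reaches-a (step e r s (inj₂ (p , _))) eq = ⊥-elim (proj₁ (avoids e s) (trans p eq))
    B-closed : ClosedUnder G A B
    B-closed e s = T-extensional (λ h → fromWitness (step e (toWitness h) s (inj₁ (refl , refl))))
                                 (λ h → fromWitness (step e (toWitness h) s (inj₂ (refl , refl))))
    Crossing : Fin (m G) → Bool
    Crossing e = S e ∧ (B (src G e) xor B (tgt G e))
    e₀-crosses : T (Crossing e₀)
    e₀-crosses = from (T-∧ {S e₀}) (s₀ , subst (λ x → T (x xor B b₀)) (sym a∉B) (fromWitness here))
    crossing-end : ∀ e → T (Crossing e) → Σ Bool λ β → endOf G e β ≡ a × Reach G A b₀ (endOf G e (not β))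
    crossing-end e h with to (T-∧ {S e}) h
    ... | s , crosses with src G e ≟ a | tgt G e ≟ a
    ...   | yes src≡a | yes tgt≡a = ⊥-elim (noLoop e s src≡a tgt≡a)
    ...   | yes src≡a | no _ = false , src≡a , toWitness (subst (λ x → T (x xor B (tgt G e))) (trans (cong B src≡a) a∉B) crosses)
    ...   | no _ | yes tgt≡a = true , tgt≡a , toWitness {a? = Reach? {G} {A} b₀ (src G e)}
                                   (subst T (trans (cong (λ y → B (src G e) xor y) (trans (cong B tgt≡a) a∉B)) (xor-identityʳ (B (src G e)))) crosses)
    ...   | no src≢a | no tgt≢a = ⊥-elim (subst T (trans (cong (_xor B (tgt G e)) (B-closed e avoiding)) (xor-same (B (tgt G e)))) crosses)
      where
      avoiding : T (A e)
      avoiding = from (T-∧ {S e}) (s , from (T-∧ {not (src G e == a)}) (subst (λ b → T (not b)) (sym (==-≢ src≢a)) tt , subst (λ b → T (not b)) (sym (==-≢ tgt≢a)) tt))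

    private
      joins-from-end : (e : Fin (m G)) (β : Bool) → endOf G e β ≡ a → Joins G e a (endOf G e (not β))
      joins-from-end e false at = inj₁ (at , refl)
      joins-from-end e true at = inj₂ (refl , at)

    flow : HasNZ2FlowOn G S
    flow with FP.any? (λ e → T? (Crossing e) ×-dec ¬? (e₀ ≟ e))
    ... | no only-e₀ = ⊥-elim (odd-1 (subst EvenNat crossing-once (even-crossing G S evenDegrees B)))
      where
      crossing-once : count (m G) Crossing ≡ 1
      crossing-once = trans (count-without (m G) Crossing e₀ e₀-crosses)
        (cong suc (count-none (m G) _ (λ e h → only-e₀ (e , proj₁ (to (T-∧ {Crossing e}) h) , ≢-from-¬== (proj₂ (to (T-∧ {Crossing e}) h))))))
    ... | yes (e₁ , crosses₁ , e₀≢e₁) with crossing-end e₁ crosses₁ | another-edge? (λ e → e₀ ≡ e ⊎ e₁ ≡ e) (λ e → (e₀ ≟ e) ⊎-dec (e₁ ≟ e))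
    ...   | β₁ , at₁ , b₀⇝x₁ | yes (e₂ , s₂ , e₂-new , touches₂) =
            split e₀ e₂ false (proj₁ (touching-end G a e₂ touches₂)) (λ p → e₂-new (inj₁ p)) s₀ s₂ refl (proj₂ (touching-end G a e₂ touches₂))
                  (SplitOffClosedSets.reconnect e₁ _ s₁ (λ p → e₀≢e₁ (sym p)) (λ p → e₂-new (inj₂ p)) (joins-from-end e₁ β₁ at₁) b₀⇝x₁)
      where
      s₁ = proj₁ (to (T-∧ {S e₁}) crosses₁)
    ...   | β₁ , at₁ , _ | no none =
            split e₀ e₁ false β₁ e₀≢e₁ s₀ s₁ refl at₁ (SplitOffClosedSets.only-two λ e s e≢e₀ e≢e₁ →
              (λ p → none (e , s , new e≢e₀ e≢e₁ , inj₁ p)) , (λ p → none (e , s , new e≢e₀ e≢e₁ , inj₂ p)))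
      where
      s₁ = proj₁ (to (T-∧ {S e₁}) crosses₁)
      new : ∀ {e} → e ≢ e₀ → e ≢ e₁ → ¬ (e₀ ≡ e ⊎ e₁ ≡ e)
      new e≢e₀ e≢e₁ (inj₁ p) = e≢e₀ (sym p)
      new e≢e₀ e≢e₁ (inj₂ p) = e≢e₁ (sym p)

  flow : HasNZ2FlowOn G S
  flow with FP.any? (λ L → T? (S L) ×-dec (src G L ≟ a) ×-dec (tgt G L ≟ a))
  ... | no noLoop = WithoutLoop.flow (λ L s srcL tgtL → noLoop (L , s , srcL , tgtL))
  ... | yes (L , sL , srcL , tgtL) with σ G L in sign
  ...   | minus = negativeLoop L sL srcL tgtL sign
  ...   | plus = lift (smaller G S′ (ℕP.≤-pred (subst (_≤ suc k) fewer bound)) (evenDegrees′ evenDegrees) (evenOnClosedSets evenClosed))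
    where open RemovePositiveLoop G S L sL (trans srcL (sym tgtL)) sign renaming (evenDegrees to evenDegrees′)

nz2Flow-bounded : (k : ℕ) → NZ2FlowsUpTo k
nz2Flow-bounded zero G S bound _ _ = emptyFlow G S (λ e s → ℕP.<⇒≱ (ℕP.≤-<-trans ℕ.z≤n (ℕP.≤-reflexive (sym (count-without (m G) S e s)))) bound)
nz2Flow-bounded (suc k) G S bound evenDegrees evenClosed with FP.any? (λ e → T? (S e))
... | no none = emptyFlow G S (λ e s → none (e , s))
... | yes (e₀ , s₀) = Reduce.flow k (nz2Flow-bounded k) G S bound evenDegrees evenClosed e₀ s₀

nz2Flow : (G : SignedGraph) (S : Fin (m G) → Bool) → EvenDegrees G S → EvenOnClosedSets G S → HasNZ2FlowOn G S
nz2Flow G S = nz2Flow-bounded (count (m G) S) G S ℕP.≤-refl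

half-parity : (s : Sign) (x : Bool) (z : ℤ) → + 2 ℤD.∣ (if x then ⟦ s ⟧ ℤ.* z else + 0) ℤ.- (if x then indℤ (oddℤ z) else + 0)
half-parity s false z = divides (+ 0) refl
half-parity s true z with oddℤ-split z
... | q , z≡ = subst (λ y → + 2 ℤD.∣ ⟦ s ⟧ ℤ.* y ℤ.- indℤ (oddℤ z)) (sym z≡) (lemma s)
  where
  r = indℤ (oddℤ z)
  lemma : ∀ s → + 2 ℤD.∣ ⟦ s ⟧ ℤ.* (+ 2 ℤ.* q ℤ.+ r) ℤ.- r
  lemma plus = divides q (eq q r)
    where
    eq : ∀ q r → + 1 ℤ.* (+ 2 ℤ.* q ℤ.+ r) ℤ.- r ≡ q ℤ.* + 2
    eq = ℤSolver.solve-∀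
  lemma minus = divides (- q ℤ.- r) (eq q r)
    where
    eq : ∀ q r → - + 1 ℤ.* (+ 2 ℤ.* q ℤ.+ r) ℤ.- r ≡ (- q ℤ.- r) ℤ.* + 2
    eq = ℤSolver.solve-∀

+-sum : {k : ℕ} (g : Fin k → ℕ) → + ℕSum.sum g ≡ ∑ k (λ i → + g i)
+-sum {zero} g = refl
+-sum {suc k} g = trans (ℤP.pos-+ (g zero) _) (cong (λ s → + g zero ℤ.+ s) (+-sum (λ i → g (suc i))))

-- Flow conservation modulo 2.
oddEdges-evenDegrees : (G : SignedGraph) (τ : Orientation G) (f : Fin (m G) → ℤ) → (∀ v → boundary G all τ f v ≡ + 0) →
                       EvenDegrees G (OddEdges G f)
oddEdges-evenDegrees G τ f conserved v = ℤ-even⇒even (degree G Q v) (subst (+ 2 ℤD.∣_) total (ℤD.∣m⇒∣-m (∣-∑ (m G) _ per-edge)))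
  where
  Q = OddEdges G f
  h : Fin (m G) → Bool → ℤ
  h e b = half G τ f v e b
  i : Fin (m G) → Bool → ℤ
  i e b = if endOf G e b == v then indℤ (Q e) else + 0
  inc : Fin (m G) → ℕ
  inc e = if Q e then ind (src G e == v) + ind (tgt G e == v) else 0
  incidences : ∀ q x y → + (if q then ind x + ind y else 0) ≡ (if x then indℤ q else + 0) ℤ.+ (if y then indℤ q else + 0)
  incidences true true true = refl
  incidences true true false = refl
  incidences true false true = refl
  incidences true false false = refl
  incidences false true true = refl
  incidences false true false = refl
  incidences false false true = refl
  incidences false false false = refl
  per-edge : ∀ e → + 2 ℤD.∣ (h e false ℤ.+ h e true) ℤ.- + inc e
  per-edge e = subst (+ 2 ℤD.∣_) (regroup (h e false) (h e true) (i e false) (i e true) (+ inc e) (sym (incidences (Q e) (src G e == v) (tgt G e == v))))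
                 (ℤD.∣m∣n⇒∣m+n (half-parity (τ e false) (src G e == v) (f e)) (half-parity (τ e true) (tgt G e == v) (f e)))
    where
    regroup : ∀ a b c d x → c ℤ.+ d ≡ x → (a ℤ.- c) ℤ.+ (b ℤ.- d) ≡ (a ℤ.+ b) ℤ.- x
    regroup a b c d x refl = solve a b c d
      where
      solve : ∀ a b c d → (a ℤ.- c) ℤ.+ (b ℤ.- d) ≡ (a ℤ.+ b) ℤ.- (c ℤ.+ d)
      solve = ℤSolver.solve-∀
  total : - ∑ (m G) (λ e → (h e false ℤ.+ h e true) ℤ.- + inc e) ≡ + degree G Q v
  total = begin
    - ∑ (m G) (λ e → (h e false ℤ.+ h e true) ℤ.- + inc e)      ≡⟨ cong -_ (∑-- (m G) _ _) ⟩
    - (boundary G all τ f v ℤ.- ∑ (m G) (λ e → + inc e))        ≡⟨ cong (λ b → - (b ℤ.- ∑ (m G) (λ e → + inc e))) (conserved v) ⟩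
    - (+ 0 ℤ.- ∑ (m G) (λ e → + inc e))                         ≡⟨ trans (cong -_ (ℤP.+-identityˡ _)) (ℤP.neg-involutive _) ⟩
    ∑ (m G) (λ e → + inc e)                                     ≡⟨ sym (+-sum inc) ⟩
    + degree G Q v                                              ∎
    where open ≡-Reasoning

lemma4p6 : (G : SignedGraph) → ¬ LongBarbell G →
    (k : ℕ) (τ : Orientation G) (f : Fin (m G) → ℤ) → IsKFlow G k τ f →
    (∀ v → EvenCard (NegEdgeOfComponent G (λ e → oddℤ (f e)) v))
    × HasNZ2FlowOn G (λ e → oddℤ (f e))
lemma4p6 G noBarbell k τ f (oriented , _ , conserved) =
  negativeEdgesOfComponent-even ,
  nz2Flow G (OddEdges G f) (oddEdges-evenDegrees G τ f conserved) evenOnClosedSets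
  where open OddEdgesEvenOnClosedSets G τ f oriented conserved noBarbell
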